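{- Let $s$ be a consistent sign pattern whose shortest negative chord is $n3$, i.e. $s(u_{n3})=-$ and $s(u_{ij})=+$ for every chord $ij$ of length $2$. Let $\alpha$ be the dihedral ordering $3,2,1,4,5,\dots,n$ (obtained by swapping $1$ and $3$) and let $t$ be the transport of $s$ to $\alpha$. Then $N(t)<N(s)$.
   Context: $\mathcal{M}_{0,n}$ is the moduli space of $n$ distinct labeled points $z_1,\dots,z_n$ on $\mathbb{P}^1$ modulo $\mathrm{PGL}_2$, $[ij|kl]=\frac{(z_i-z_k)(z_j-z_l)}{(z_i-z_l)(z_j-z_k)}$. Positions/labels are cyclic mod $n$; a chord is an unordered pair $\{p,q\}$ with $q\notin\{p-1,p,p+1\}$, of length $\min(|p-q|,n-|p-q|)$. Standard dihedral coordinates: $u_{ij}=[i,i+1|j+1,j]$ ($u_{ij}=u_{ji}$). For a dihedral ordering $\alpha$ (bijection from positions to labels) set $u^\alpha_{pq}=[\alpha(p),\alpha(p+1)|\alpha(q+1),\alpha(q)]$. A sign pattern $s$ assigns $\pm$ to each $u_{ij}$; $N(s)$ is its number of negative entries. Consistency: for every partition of the labels into four non-empty cyclic intervals $A,B,C,D$ in cyclic order, $\prod_{i\in A,j\in C}u_{ij}+\prod_{k\in B,l\in D}u_{kl}=1$ on $\mathcal{M}_{0,n}$, and $s$ is consistent if for no such partition both monomials are negative under $s$. Transport: each function $u^\alpha_{pq}$ on $\mathcal{M}_{0,n}$ can be written uniquely as $\varepsilon\prod u_{kl}^{e_{kl}}$ with $\varepsilon\in\{\pm1\}$, $e_{kl}\in\mathbb{Z}$;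 the transport of $s$ to $\alpha$ is the sign pattern $t$ with $t(u^\alpha_{pq})=\varepsilon\prod s(u_{kl})^{e_{kl}}$, and $N(t)$ is its number of negative entries. -}

module Defs where

open import Data.Bool using (Bool; true; false; if_then_else_; _∧_; _∨_; not; T)
open import Data.Nat using (ℕ; zero; suc; _+_; _∸_; _<_; _≤_; _≡ᵇ_; _<ᵇ_; _≤ᵇ_; _%_)
open import Data.Integer as ℤ using (ℤ; ∣_∣)
open import Data.List using (List; []; _∷_; map; concatMap; foldr; upTo; length; filterᵇ; _++_)
open import Data.Product using (_×_; _,_; proj₁; proj₂)
open import Relation.Binary.PropositionalEquality using (_≡_)
open import Relation.Nullary using (¬_)

-- Conventions: the labels 1,…,n of the paper are encoded 0-based as the
-- naturals 0,…,n-1 (paper label k ↔ k-1).  Positions likewise.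

data Sign : Set where
  plus minus : Sign

_·_ : Sign → Sign → Sign
plus  · s = s
minus · plus = minus
minus · minus = plus

isMinus : Sign → Bool
isMinus plus = false
isMinus minus = true

cycLen : ℕ → ℕ → ℕ → ℕ
cycLen n i j = let d = j ∸ i in if d ≤ᵇ (n ∸ d) then d else n ∸ d

isChordᵇ : ℕ → ℕ → ℕ → Bool
isChordᵇ n i j = (i <ᵇ j) ∧ (j <ᵇ n) ∧ (2 ≤ᵇ cycLen n i j)

IsChord : ℕ → ℕ → ℕ → Set
IsChord n i j = T (isChordᵇ n i j)

chords : ℕ → List (ℕ × ℕ)
chords n = filterᵇ (λ c → isChordᵇ n (proj₁ c) (proj₂ c))
                   (concatMap (λ i → map (λ j → (i , j)) (upTo n)) (upTo n))

-- A sign pattern: s i j is the sign of u_{ij} for a chord i < j.  Values at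
-- non-chords (and at i ≥ j) are never used.
SignPattern : Set
SignPattern = ℕ → ℕ → Sign

sval : SignPattern → ℕ → ℕ → Sign
sval s i j = if i <ᵇ j then s i j else s j i

N : ℕ → SignPattern → ℕ
N n s = length (filterᵇ (λ c → isMinus (s (proj₁ c) (proj₂ c))) (chords n))

nxt : ℕ → ℕ → ℕ
nxt n k = if suc k ≡ᵇ n then 0 else suc k

prodS : List Sign → Sign
prodS = foldr _·_ plus

interval : ℕ → ℕ → List ℕ
interval a b = map (λ k → a + k) (upTo (b ∸ a))

prodPairs : SignPattern → List ℕ → List ℕ → Sign
prodPairs s I J = prodS (concatMap (λ i → map (λ j → sval s i j) J) I)

-- Partitions of the labels into four non-empty cyclic intervals in cyclic
-- order: A = [a,b), B = [b,c), C = [c,d), D = [d,n) ∪ [0,a), for a<b<c<d<n.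
Consistent : ℕ → SignPattern → Set
Consistent n s = ∀ a b c d → a < b → b < c → c < d → d < n →
  ¬ ( prodPairs s (interval a b) (interval c d) ≡ minus
    × prodPairs s (interval b c) (interval d n ++ interval 0 a) ≡ minus )

-- Functions on M_{0,n} of the shape  ±∏_{a<b} (z_a - z_b)^{m_ab}.
-- Two such rational functions are equal iff the signs and all exponents agree
-- (unique factorisation; the z_a - z_b, a < b, are pairwise non-associate primes).
record ZMon : Set where
  constructor zmon
  field
    sgn : Sign
    ex  : ℕ → ℕ → ℤ      -- exponent of (z_a - z_b), used for a < b

open ZMon public

_≈Z_ : ℕ → ZMon → ZMon → Set
_≈Z_ n m m' = (sgn m ≡ sgn m') × (∀ a b → a < b → b < n → ex m a b ≡ ex m' a b)

oneZ : ZMon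
oneZ = zmon plus (λ _ _ → ℤ.0ℤ)

mulZ : ZMon → ZMon → ZMon
mulZ m m' = zmon (sgn m · sgn m') (λ a b → ex m a b ℤ.+ ex m' a b)

invZ : ZMon → ZMon
invZ m = zmon (sgn m) (λ a b → ℤ.- ex m a b)

oddℤ : ℤ → Bool
oddℤ e = (∣ e ∣ % 2) ≡ᵇ 1

powS : Sign → ℤ → Sign
powS σ e = if oddℤ e then σ else plus

powZ : ZMon → ℤ → ZMon
powZ m e = zmon (powS (sgn m) e) (λ a b → e ℤ.* ex m a b)

lin : ℕ → ℕ → ZMon
lin x y = zmon (if x <ᵇ y then plus else minus)
               (λ a b → if (a ≡ᵇ lo) ∧ (b ≡ᵇ hi) then ℤ.1ℤ else ℤ.0ℤ)
  where
    lo = if x <ᵇ y then x else y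
    hi = if x <ᵇ y then y else x

cross : ℕ → ℕ → ℕ → ℕ → ZMon
cross i j k l = mulZ (mulZ (lin i k) (lin j l)) (invZ (mulZ (lin i l) (lin j k)))

uZ : ℕ → ℕ → ℕ → ZMon
uZ n k l = cross k (nxt n k) (nxt n l) l

uMon : ℕ → Sign → (ℕ → ℕ → ℤ) → ZMon
uMon n ε e = mulZ (zmon ε (λ _ _ → ℤ.0ℤ))
                  (foldr (λ c m → mulZ (powZ (uZ n (proj₁ c) (proj₂ c)) (e (proj₁ c) (proj₂ c))) m)
                         oneZ (chords n))

evalSign : ℕ → SignPattern → Sign → (ℕ → ℕ → ℤ) → Sign
evalSign n s ε e = ε · prodS (map (λ c → powS (s (proj₁ c) (proj₂ c)) (e (proj₁ c) (proj₂ c))) (chords n))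

Ordering : Set
Ordering = ℕ → ℕ       -- position ↦ label

uα : ℕ → Ordering → ℕ → ℕ → ZMon
uα n α p q = cross (α p) (α (nxt n p)) (α (nxt n q)) (α q)

-- t is the transport of s to α: for every chord pq of positions, t(u^α_pq)
-- equals ε ∏ s(u_kl)^{e_kl} for the (unique) representation
-- u^α_pq = ε ∏ u_kl^{e_kl} as functions on M_{0,n}.
IsTransport : ℕ → SignPattern → Ordering → SignPattern → Set
IsTransport n s α t = ∀ p q → IsChord n p q →
  ∀ (ε : Sign) (e : ℕ → ℕ → ℤ) → _≈Z_ n (uMon n ε e) (uα n α p q) →
  t p q ≡ evalSign n s ε e

-- the ordering 3,2,1,4,5,…,n (0-based: positions 0,1,2 ↦ labels 2,1,0)
swap13 : Ordering
swap13 p = if p ≡ᵇ 0 then 2 else if p ≡ᵇ 2 then 0 else p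

{-# OPTIONS --safe #-}
-- Swapping the labels 1 and 3 changes only the coordinates u_{ij} with an endpoint in {1, 2, 3, n}.
-- Writing x_j = s(u_{1j}) and y_j = s(u_{2j}), the transport exchanges x_j and y_j, multiplies
-- s(u_{3j}) and s(u_{jn}) by x_j y_j, and gives u_{13}, u_{2n}, u_{3n} the signs ∏_j y_j · s(u_{2n}),
-- s(u_{13}) · ∏_j x_j and −∏_j x_j · ∏_j y_j · s(u_{3n}); all of this is read off from exponent
-- identities between cross ratios. Consistency for the four-interval partitions cut next to a label j
-- forces ∏_j x_j = ∏_j y_j = +, so these three coordinates become positive, whereas s(u_{3n}) = −; and
-- whenever x_j y_j = − it forces one of s(u_{3j}), s(u_{jn}) to be negative, so the flips never increase
-- the number of negative entries.
-- Labels are 0-based as in Defs; below n = 6 + m and L = 5 + m is the last label.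
module Submission where

open import Defs
open import Algebra.Bundles using (CommutativeSemigroup)
import Algebra.Properties.CommutativeSemigroup
import Algebra.Structures as Structures
open import Data.Bool using (Bool; true; false; if_then_else_; _∨_; T)
open import Data.Bool.Properties using (T-≡; ∨-conicalˡ; ∨-conicalʳ)
open import Data.Empty using (⊥-elim)
open import Data.Integer as ℤ using (ℤ; 0ℤ; 1ℤ; -1ℤ)
import Data.Integer.Properties as ℤ
open import Data.Integer.Tactic.RingSolver using (solve-∀)
open import Data.List using (List; []; _∷_; map; concatMap; filterᵇ; _++_; applyUpTo; upTo; length; foldr)
open import Data.Nat using (ℕ; zero; suc; _+_; _∸_; _<_; _≤_; z≤n; s≤s; _≡ᵇ_; _<ᵇ_; _≤ᵇ_)
import Data.Nat.Properties as ℕ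
open import Data.Product using (_×_; _,_; proj₁; proj₂)
import Data.Product as Product
open import Data.Sum using (_⊎_; inj₁; inj₂)
import Data.Sum as Sum
open import Data.Unit using (tt)
open import Function using (_∘_; id)
open import Function.Bundles using (module Equivalence)
open import Level using (0ℓ)
open import Relation.Binary using (tri<; tri≈; tri>)
open import Relation.Binary.PropositionalEquality
open import Relation.Nullary using (¬_; yes; no)

if-true : ∀ {B : Set} {b} {x y : B} → b ≡ true → (if b then x else y) ≡ x
if-true refl = refl

if-false : ∀ {B : Set} {b} {x y : B} → b ≡ false → (if b then x else y) ≡ y
if-false refl = refl

≡true⇒T : ∀ {b} → b ≡ true → T b
≡true⇒T = Equivalence.from T-≡

T⇒≡true : ∀ {b} → T b → b ≡ true
T⇒≡true = Equivalence.to T-≡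

¬T⇒≡false : ∀ {b} → ¬ T b → b ≡ false
¬T⇒≡false {true}  ¬t = ⊥-elim (¬t tt)
¬T⇒≡false {false} _  = refl

≡ᵇ-true : ∀ {m n} → m ≡ n → (m ≡ᵇ n) ≡ true
≡ᵇ-true {m} {n} m≡n = T⇒≡true (ℕ.≡⇒≡ᵇ m n m≡n)

≡ᵇ-false : ∀ {m n} → m ≢ n → (m ≡ᵇ n) ≡ false
≡ᵇ-false {m} {n} m≢n = ¬T⇒≡false (m≢n ∘ ℕ.≡ᵇ⇒≡ m n)

≡ᵇ-refl : ∀ m → (m ≡ᵇ m) ≡ true
≡ᵇ-refl m = ≡ᵇ-true {m} refl

<ᵇ-true : ∀ {m n} → m < n → (m <ᵇ n) ≡ true
<ᵇ-true m<n = T⇒≡true (ℕ.<⇒<ᵇ m<n)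

<ᵇ-false : ∀ {m n} → n ≤ m → (m <ᵇ n) ≡ false
<ᵇ-false {m} {n} n≤m = ¬T⇒≡false λ m<ᵇn → ℕ.<⇒≱ (ℕ.<ᵇ⇒< m n m<ᵇn) n≤m

≤ᵇ-true : ∀ {m n} → m ≤ n → (m ≤ᵇ n) ≡ true
≤ᵇ-true m≤n = T⇒≡true (ℕ.≤⇒≤ᵇ m≤n)

record ChordBounds (n i j : ℕ) : Set where
  constructor chordBounds
  field
    i<j     : i < j
    j<n     : j < n
    2≤gap   : 2 ≤ j ∸ i
    2≤cogap : 2 ≤ n ∸ (j ∸ i)

chord-intro : ∀ {n i j} → ChordBounds n i j → isChordᵇ n i j ≡ true
chord-intro {n} {i} {j} (chordBounds i<j j<n 2≤gap 2≤cogap)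
  rewrite <ᵇ-true i<j | <ᵇ-true j<n with (j ∸ i) ≤ᵇ (n ∸ (j ∸ i))
... | true  = ≤ᵇ-true 2≤gap
... | false = ≤ᵇ-true 2≤cogap

cycLen-gaps : ∀ n i j → (2 ≤ᵇ cycLen n i j) ≡ true → 2 ≤ j ∸ i × 2 ≤ n ∸ (j ∸ i)
cycLen-gaps n i j long with (j ∸ i) ≤ᵇ (n ∸ (j ∸ i)) in short
... | true  = 2≤gap , ℕ.≤-trans 2≤gap (ℕ.≤ᵇ⇒≤ _ _ (≡true⇒T short))
  where
    2≤gap : 2 ≤ j ∸ i
    2≤gap = ℕ.≤ᵇ⇒≤ 2 _ (≡true⇒T long)
... | false = ℕ.≤-trans 2≤cogap (ℕ.<⇒≤ (ℕ.≰⇒> λ gap≤ → subst T short (ℕ.≤⇒≤ᵇ gap≤))) , 2≤cogap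
  where
    2≤cogap : 2 ≤ n ∸ (j ∸ i)
    2≤cogap = ℕ.≤ᵇ⇒≤ 2 _ (≡true⇒T long)

chord-elim : ∀ {n i j} → isChordᵇ n i j ≡ true → ChordBounds n i j
chord-elim {n} {i} {j} c with i <ᵇ j in i<j | j <ᵇ n in j<n | 2 ≤ᵇ cycLen n i j in long
... | true | true | true = chordBounds (ℕ.<ᵇ⇒< i j (≡true⇒T i<j)) (ℕ.<ᵇ⇒< j n (≡true⇒T j<n))
                                       (proj₁ (cycLen-gaps n i j long)) (proj₂ (cycLen-gaps n i j long))

chord-absent : ∀ {n i j} → ¬ ChordBounds n i j → isChordᵇ n i j ≡ false
chord-absent {n} {i} {j} ¬chord with isChordᵇ n i j in c
... | true  = ⊥-elim (¬chord (chord-elim c))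
... | false = refl

suc-<-of-chord : ∀ {n k l} → ChordBounds n k l → suc k < l
suc-<-of-chord {k = k} (chordBounds k<l _ 2≤gap _) =
  ℕ.≤-trans (ℕ.+-monoˡ-≤ k 2≤gap) (ℕ.≤-reflexive (ℕ.m∸n+n≡m (ℕ.<⇒≤ k<l)))

2≤2+x∸k : ∀ x {k} → k ≤ x → 2 ≤ (2 + x) ∸ k
2≤2+x∸k x k≤x rewrite ℕ.+-∸-assoc 2 k≤x = s≤s (s≤s z≤n)

chord-from-0 : ∀ m {k} → k ≤ 1 + m → isChordᵇ (6 + m) 0 (3 + k) ≡ true
chord-from-0 m {k} k≤ = chord-intro (chordBounds (s≤s z≤n) (ℕ.+-monoʳ-< 3 (s≤s (ℕ.m≤n⇒m≤1+n k≤)))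
                                                 (s≤s (s≤s z≤n)) (2≤2+x∸k (1 + m) k≤))

chord-from-1 : ∀ m {k} → k ≤ 2 + m → isChordᵇ (6 + m) 1 (3 + k) ≡ true
chord-from-1 m {k} k≤ = chord-intro (chordBounds (s≤s (s≤s z≤n)) (ℕ.+-monoʳ-< 3 (s≤s k≤))
                                                 (s≤s (s≤s z≤n)) (2≤2+x∸k (2 + m) k≤))

chord-from-2 : ∀ m {k} → k ≤ 1 + m → isChordᵇ (6 + m) 2 (4 + k) ≡ true
chord-from-2 m {k} k≤ = chord-intro (chordBounds (s≤s (s≤s (s≤s z≤n))) (ℕ.+-monoʳ-< 4 (s≤s k≤))
                                                 (s≤s (s≤s z≤n)) (2≤2+x∸k (2 + m) (ℕ.m≤n⇒m≤1+n k≤)))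

chord-to-last : ∀ m {k} → k ≤ m → isChordᵇ (6 + m) (3 + k) (5 + m) ≡ true
chord-to-last m {k} k≤ = chord-intro (chordBounds (ℕ.+-monoʳ-< 3 (s≤s (ℕ.m≤n⇒m≤1+n k≤))) (ℕ.n<1+n _)
                                                  (2≤2+x∸k m k≤) (2≤2+x∸k (4 + m) gap≤))
  where
    gap≤ : (2 + m) ∸ k ≤ 4 + m
    gap≤ = ℕ.≤-trans (ℕ.m∸n≤m (2 + m) k) (ℕ.m≤n+m (2 + m) 2)

not-chord-0-last : ∀ m → isChordᵇ (6 + m) 0 (5 + m) ≡ false
not-chord-0-last m = chord-absent {6 + m} {0} {5 + m} λ c →
  ℕ.<-irrefl refl (subst (2 ≤_) (ℕ.m+n∸n≡m 1 m) (ChordBounds.2≤cogap c))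

not-chord-side-last : ∀ m → isChordᵇ (6 + m) (4 + m) (5 + m) ≡ false
not-chord-side-last m = chord-absent {6 + m} {4 + m} {5 + m} λ c →
  ℕ.<-irrefl refl (subst (2 ≤_) (ℕ.m+n∸n≡m 1 m) (ChordBounds.2≤gap c))

not-chord-last-last : ∀ m → isChordᵇ (6 + m) (5 + m) (5 + m) ≡ false
not-chord-last-last m = chord-absent {6 + m} {5 + m} {5 + m} λ c → ℕ.<-irrefl refl (ChordBounds.i<j c)

-- Sums over chords

module FiniteSum {A : Set} {_∙_ : A → A → A} {ε : A}
  (isCommutativeMonoid : Structures.IsCommutativeMonoid {A = A} _≡_ _∙_ ε) where

  open Structures.IsCommutativeMonoid isCommutativeMonoid
    using (assoc; identityˡ; identityʳ; isCommutativeSemigroup)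

  commutativeSemigroup : CommutativeSemigroup 0ℓ 0ℓ
  commutativeSemigroup = record { isCommutativeSemigroup = isCommutativeSemigroup }

  open Algebra.Properties.CommutativeSemigroup commutativeSemigroup using (interchange)

  ∑< : ℕ → (ℕ → A) → A
  ∑< zero    f = ε
  ∑< (suc n) f = f 0 ∙ ∑< n (f ∘ suc)

  ∑<-cong : ∀ n {f g : ℕ → A} → (∀ k → k < n → f k ≡ g k) → ∑< n f ≡ ∑< n g
  ∑<-cong zero    f≗g = refl
  ∑<-cong (suc n) f≗g = cong₂ _∙_ (f≗g 0 (s≤s z≤n)) (∑<-cong n (λ k k<n → f≗g (suc k) (s≤s k<n)))

  ∑<-ε : ∀ n {f : ℕ → A} → (∀ k → k < n → f k ≡ ε) → ∑< n f ≡ ε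
  ∑<-ε zero    _   = refl
  ∑<-ε (suc n) f≗ε =
    trans (cong₂ _∙_ (f≗ε 0 (s≤s z≤n)) (∑<-ε n λ k k<n → f≗ε (suc k) (s≤s k<n))) (identityˡ ε)

  ∑<-∙ : ∀ n (f g : ℕ → A) → ∑< n (λ k → f k ∙ g k) ≡ ∑< n f ∙ ∑< n g
  ∑<-∙ zero    f g = sym (identityˡ ε)
  ∑<-∙ (suc n) f g = trans (cong ((f 0 ∙ g 0) ∙_) (∑<-∙ n _ _)) (interchange _ _ _ _)

  ∑<-+ : ∀ a b (f : ℕ → A) → ∑< (a + b) f ≡ ∑< a f ∙ ∑< b (λ k → f (a + k))
  ∑<-+ zero    b f = sym (identityˡ _)
  ∑<-+ (suc a) b f = trans (cong (f 0 ∙_) (∑<-+ a b _)) (sym (assoc _ _ _))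

  ∑<-sucʳ : ∀ n (f : ℕ → A) → ∑< (suc n) f ≡ ∑< n f ∙ f n
  ∑<-sucʳ n f = trans (cong (λ m → ∑< m f) (ℕ.+-comm 1 n))
                      (trans (∑<-+ n 1 f) (cong (∑< n f ∙_) (trans (identityʳ _) (cong f (ℕ.+-identityʳ n)))))

  ∑<-single : ∀ n p (f : ℕ → A) → p < n → (∀ k → k < n → k ≢ p → f k ≡ ε) → ∑< n f ≡ f p
  ∑<-single (suc n) zero f _ f≗ε =
    trans (cong (f 0 ∙_) (∑<-ε n (λ k k<n → f≗ε (suc k) (s≤s k<n) λ ()))) (identityʳ _)
  ∑<-single (suc n) (suc p) f (s≤s p<n) f≗ε =
    trans (cong₂ _∙_ (f≗ε 0 (s≤s z≤n) λ ())
                     (∑<-single n p _ p<n λ k k<n k≢p → f≗ε (suc k) (s≤s k<n) (k≢p ∘ ℕ.suc-injective)))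
          (identityˡ _)

  ∑<-if-true : ∀ N (h : ℕ → Bool) (g : ℕ → A) → (∀ k → k < N → h k ≡ true) →
    ∑< N (λ k → if h k then g k else ε) ≡ ∑< N g
  ∑<-if-true N h g h≡true = ∑<-cong N λ k k<N → if-true (h≡true k k<N)

  foldMap : {B : Set} → (B → A) → List B → A
  foldMap g = foldr (λ x r → g x ∙ r) ε

  foldMap-++ : {B : Set} (g : B → A) (xs ys : List B) → foldMap g (xs ++ ys) ≡ foldMap g xs ∙ foldMap g ys
  foldMap-++ g []       ys = sym (identityˡ _)
  foldMap-++ g (x ∷ xs) ys = trans (cong (g x ∙_) (foldMap-++ g xs ys)) (sym (assoc _ _ _))

  foldMap-map : {B C : Set} (g : C → A) (h : B → C) (xs : List B) → foldMap g (map h xs) ≡ foldMap (g ∘ h) xs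
  foldMap-map g h []       = refl
  foldMap-map g h (x ∷ xs) = cong (g (h x) ∙_) (foldMap-map g h xs)

  foldMap-concatMap : {B C : Set} (g : C → A) (h : B → List C) (xs : List B) →
    foldMap g (concatMap h xs) ≡ foldMap (foldMap g ∘ h) xs
  foldMap-concatMap g h []       = refl
  foldMap-concatMap g h (x ∷ xs) = trans (foldMap-++ g (h x) (concatMap h xs)) (cong (_ ∙_) (foldMap-concatMap g h xs))

  foldMap-filter : {B : Set} (g : B → A) (p : B → Bool) (xs : List B) →
    foldMap g (filterᵇ p xs) ≡ foldMap (λ x → if p x then g x else ε) xs
  foldMap-filter g p []       = refl
  foldMap-filter g p (x ∷ xs) with p x
  ... | true  = cong (g x ∙_) (foldMap-filter g p xs)
  ... | false = trans (foldMap-filter g p xs) (sym (identityˡ _))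

  foldMap-cong : {B : Set} {g h : B → A} → (∀ x → g x ≡ h x) → ∀ xs → foldMap g xs ≡ foldMap h xs
  foldMap-cong g≗h []       = refl
  foldMap-cong g≗h (x ∷ xs) = cong₂ _∙_ (g≗h x) (foldMap-cong g≗h xs)

  foldMap-applyUpTo : (g : ℕ → A) (h : ℕ → ℕ) (n : ℕ) → foldMap g (applyUpTo h n) ≡ ∑< n (g ∘ h)
  foldMap-applyUpTo g h zero    = refl
  foldMap-applyUpTo g h (suc n) = cong (g (h 0) ∙_) (foldMap-applyUpTo g (h ∘ suc) n)

  foldMap-upTo : (g : ℕ → A) (n : ℕ) → foldMap g (upTo n) ≡ ∑< n g
  foldMap-upTo g = foldMap-applyUpTo g id

  ∑ᶜ-row : ℕ → ℕ → (ℕ → A) → A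
  ∑ᶜ-row n r g = ∑< n (λ j → if isChordᵇ n r j then g j else ε)

  ∑ᶜ : ℕ → (ℕ → ℕ → A) → A
  ∑ᶜ n G = ∑< n λ i → ∑ᶜ-row n i (G i)

  ∑ᶜ-cong : ∀ n {G H : ℕ → ℕ → A} → (∀ i j → isChordᵇ n i j ≡ true → G i j ≡ H i j) →
    ∑ᶜ n G ≡ ∑ᶜ n H
  ∑ᶜ-cong n {G} {H} G≗H = ∑<-cong n λ i _ → ∑<-cong n λ j _ → onChord i j (isChordᵇ n i j) refl
    where
      onChord : ∀ i j b → isChordᵇ n i j ≡ b → (if b then G i j else ε) ≡ (if b then H i j else ε)
      onChord i j true  c = G≗H i j c
      onChord i j false _ = refl

  ∑ᶜ-∙ : ∀ n (G H : ℕ → ℕ → A) → ∑ᶜ n (λ i j → G i j ∙ H i j) ≡ ∑ᶜ n G ∙ ∑ᶜ n H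
  ∑ᶜ-∙ n G H =
    trans (∑<-cong n λ i _ → trans (∑<-cong n λ j _ → if-∙ (isChordᵇ n i j)) (∑<-∙ n _ _)) (∑<-∙ n _ _)
    where
      if-∙ : ∀ {x y} b → (if b then x ∙ y else ε) ≡ (if b then x else ε) ∙ (if b then y else ε)
      if-∙ true  = refl
      if-∙ false = sym (identityˡ ε)

  ∑ᶜ-ε : ∀ n → ∑ᶜ n (λ _ _ → ε) ≡ ε
  ∑ᶜ-ε n = ∑<-ε n λ i _ → ∑<-ε n λ j _ → if-ε (isChordᵇ n i j)
    where
      if-ε : ∀ b → (if b then ε else ε) ≡ ε
      if-ε true  = refl
      if-ε false = refl

  foldMap-chords : ∀ n (g : ℕ × ℕ → A) → foldMap g (chords n) ≡ ∑ᶜ n (λ i j → g (i , j))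
  foldMap-chords n g = begin
    foldMap g (chords n)
      ≡⟨ foldMap-filter g (λ c → isChordᵇ n (proj₁ c) (proj₂ c)) (concatMap row (upTo n)) ⟩
    foldMap g′ (concatMap row (upTo n))
      ≡⟨ foldMap-concatMap g′ row (upTo n) ⟩
    foldMap (foldMap g′ ∘ row) (upTo n)
      ≡⟨ foldMap-upTo _ n ⟩
    ∑< n (foldMap g′ ∘ row)
      ≡⟨ ∑<-cong n (λ i _ → trans (foldMap-map g′ (i ,_) (upTo n)) (foldMap-upTo _ n)) ⟩
    ∑ᶜ n (λ i j → g (i , j)) ∎
    where
      open ≡-Reasoning
      g′ : ℕ × ℕ → A
      g′ c = if isChordᵇ n (proj₁ c) (proj₂ c) then g c else ε
      row : ℕ → List (ℕ × ℕ)
      row i = map (i ,_) (upTo n)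

  ∑ᶜ-row-single : ∀ n r q (g : ℕ → A) → q < n →
    ∑ᶜ-row n r (λ j → if j ≡ᵇ q then g j else ε) ≡ (if isChordᵇ n r q then g q else ε)
  ∑ᶜ-row-single n r q g q<n = trans (∑<-single n q _ q<n offColumn) onColumn
    where
      offColumn : ∀ j → j < n → j ≢ q → (if isChordᵇ n r j then (if j ≡ᵇ q then g j else ε) else ε) ≡ ε
      offColumn j _ j≢q rewrite ≡ᵇ-false j≢q with isChordᵇ n r j
      ... | true  = refl
      ... | false = refl
      onColumn : (if isChordᵇ n r q then (if q ≡ᵇ q then g q else ε) else ε) ≡ (if isChordᵇ n r q then g q else ε)
      onColumn rewrite ≡ᵇ-refl q = refl

  ∑ᶜ-row-0 : ∀ m g → ∑ᶜ-row (6 + m) 0 g ≡ g 2 ∙ ∑< (2 + m) (λ k → g (3 + k))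
  ∑ᶜ-row-0 m g = begin
    ε ∙ (ε ∙ (g 2 ∙ ∑< (3 + m) (λ k → if isChordᵇ (6 + m) 0 (3 + k) then g (3 + k) else ε)))
      ≡⟨ trans (identityˡ _) (identityˡ _) ⟩
    g 2 ∙ ∑< (3 + m) (λ k → if isChordᵇ (6 + m) 0 (3 + k) then g (3 + k) else ε)
      ≡⟨ cong (g 2 ∙_) (∑<-sucʳ (2 + m) (λ k → if isChordᵇ (6 + m) 0 (3 + k) then g (3 + k) else ε)) ⟩
    g 2 ∙ (∑< (2 + m) (λ k → if isChordᵇ (6 + m) 0 (3 + k) then g (3 + k) else ε)
             ∙ (if isChordᵇ (6 + m) 0 (5 + m) then g (5 + m) else ε))
      ≡⟨ cong (g 2 ∙_) (cong₂ _∙_ (∑<-if-true (2 + m) (λ k → isChordᵇ (6 + m) 0 (3 + k)) (λ k → g (3 + k))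
                                              λ k k< → chord-from-0 m (ℕ.≤-pred k<))
                                  (if-false (not-chord-0-last m))) ⟩
    g 2 ∙ (∑< (2 + m) (λ k → g (3 + k)) ∙ ε)
      ≡⟨ cong (g 2 ∙_) (identityʳ _) ⟩
    g 2 ∙ ∑< (2 + m) (λ k → g (3 + k)) ∎
    where open ≡-Reasoning

  ∑ᶜ-row-1 : ∀ m g → ∑ᶜ-row (6 + m) 1 g ≡ ∑< (2 + m) (λ k → g (3 + k)) ∙ g (5 + m)
  ∑ᶜ-row-1 m g = begin
    ε ∙ (ε ∙ (ε ∙ ∑< (3 + m) (λ k → if isChordᵇ (6 + m) 1 (3 + k) then g (3 + k) else ε)))
      ≡⟨ trans (identityˡ _) (trans (identityˡ _) (identityˡ _)) ⟩
    ∑< (3 + m) (λ k → if isChordᵇ (6 + m) 1 (3 + k) then g (3 + k) else ε)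
      ≡⟨ ∑<-if-true (3 + m) (λ k → isChordᵇ (6 + m) 1 (3 + k)) (λ k → g (3 + k))
                    (λ k k< → chord-from-1 m (ℕ.≤-pred k<)) ⟩
    ∑< (3 + m) (λ k → g (3 + k))
      ≡⟨ ∑<-sucʳ (2 + m) (λ k → g (3 + k)) ⟩
    ∑< (2 + m) (λ k → g (3 + k)) ∙ g (5 + m) ∎
    where open ≡-Reasoning

  ∑ᶜ-row-2 : ∀ m g → ∑ᶜ-row (6 + m) 2 g ≡ ∑< (1 + m) (λ k → g (4 + k)) ∙ g (5 + m)
  ∑ᶜ-row-2 m g = begin
    ε ∙ (ε ∙ (ε ∙ (ε ∙ ∑< (2 + m) (λ k → if isChordᵇ (6 + m) 2 (4 + k) then g (4 + k) else ε))))
      ≡⟨ trans (identityˡ _) (trans (identityˡ _) (trans (identityˡ _) (identityˡ _))) ⟩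
    ∑< (2 + m) (λ k → if isChordᵇ (6 + m) 2 (4 + k) then g (4 + k) else ε)
      ≡⟨ ∑<-if-true (2 + m) (λ k → isChordᵇ (6 + m) 2 (4 + k)) (λ k → g (4 + k))
                    (λ k k< → chord-from-2 m (ℕ.≤-pred k<)) ⟩
    ∑< (2 + m) (λ k → g (4 + k))
      ≡⟨ ∑<-sucʳ (1 + m) (λ k → g (4 + k)) ⟩
    ∑< (1 + m) (λ k → g (4 + k)) ∙ g (5 + m) ∎
    where open ≡-Reasoning

  ∑<-column-last : ∀ m (g : ℕ → A) →
    ∑< (3 + m) (λ k → if isChordᵇ (6 + m) (3 + k) (5 + m) then g k else ε) ≡ ∑< (1 + m) g
  ∑<-column-last m g = begin
    ∑< (3 + m) G
      ≡⟨ trans (∑<-sucʳ (2 + m) G) (cong (_∙ G (2 + m)) (∑<-sucʳ (1 + m) G)) ⟩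
    (∑< (1 + m) G ∙ G (1 + m)) ∙ G (2 + m)
      ≡⟨ cong₂ (λ x y → (x ∙ y) ∙ G (2 + m))
               (∑<-if-true (1 + m) (λ k → isChordᵇ (6 + m) (3 + k) (5 + m)) g λ k k< → chord-to-last m (ℕ.≤-pred k<))
               (if-false (not-chord-side-last m)) ⟩
    (∑< (1 + m) g ∙ ε) ∙ G (2 + m)
      ≡⟨ cong ((∑< (1 + m) g ∙ ε) ∙_) (if-false (not-chord-last-last m)) ⟩
    (∑< (1 + m) g ∙ ε) ∙ ε
      ≡⟨ trans (identityʳ _) (identityʳ _) ⟩
    ∑< (1 + m) g ∎
    where
      open ≡-Reasoning
      G : ℕ → A
      G k = if isChordᵇ (6 + m) (3 + k) (5 + m) then g k else ε

·-assoc : ∀ σ τ υ → (σ · τ) · υ ≡ σ · (τ · υ)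
·-assoc plus  τ     υ     = refl
·-assoc minus plus  υ     = refl
·-assoc minus minus plus  = refl
·-assoc minus minus minus = refl

·-comm : ∀ σ τ → σ · τ ≡ τ · σ
·-comm plus  plus  = refl
·-comm plus  minus = refl
·-comm minus plus  = refl
·-comm minus minus = refl

·-identityʳ : ∀ σ → σ · plus ≡ σ
·-identityʳ plus  = refl
·-identityʳ minus = refl

·-selfInverse : ∀ σ τ → σ · (σ · τ) ≡ τ
·-selfInverse plus  τ     = refl
·-selfInverse minus plus  = refl
·-selfInverse minus minus = refl

·-isCommutativeMonoid : Structures.IsCommutativeMonoid _≡_ _·_ plus
·-isCommutativeMonoid = record
  { isMonoid = record
    { isSemigroup = record
      { isMagma = record { isEquivalence = isEquivalence ; ∙-cong = cong₂ _·_ }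
      ; assoc = ·-assoc }
    ; identity = (λ _ → refl) , ·-identityʳ }
  ; comm = ·-comm }

plus≢minus : plus ≢ minus
plus≢minus ()

·-inverse : ∀ σ → σ · σ ≡ plus
·-inverse plus  = refl
·-inverse minus = refl

powS-plus : ∀ e → powS plus e ≡ plus
powS-plus e with oddℤ e
... | true  = refl
... | false = refl

χ⁻ : Sign → ℕ
χ⁻ σ = if isMinus σ then 1 else 0

module ℕ-Sum = FiniteSum ℕ.+-0-isCommutativeMonoid
module ℤ-Sum = FiniteSum ℤ.+-0-isCommutativeMonoid
module Sign-Prod = FiniteSum ·-isCommutativeMonoid
module Sign-Algebra = Algebra.Properties.CommutativeSemigroup Sign-Prod.commutativeSemigroup
module ℕ-Algebra = Algebra.Properties.CommutativeSemigroup ℕ.+-commutativeSemigroup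

∏< : ℕ → (ℕ → Sign) → Sign
∏< = Sign-Prod.∑<

∏<-interval : ∀ (f : ℕ → Sign) {c d} → c ≤ d → ∏< (d ∸ c) (λ k → f (c + k)) ≡ ∏< c f · ∏< d f
∏<-interval f {c} {d} c≤d = begin
  ∏< (d ∸ c) (λ k → f (c + k))
    ≡⟨ ·-selfInverse (∏< c f) _ ⟨
  ∏< c f · (∏< c f · ∏< (d ∸ c) (λ k → f (c + k)))
    ≡⟨ cong (∏< c f ·_) (Sign-Prod.∑<-+ c (d ∸ c) f) ⟨
  ∏< c f · ∏< (c + (d ∸ c)) f
    ≡⟨ cong (λ e → ∏< c f · ∏< e f) (ℕ.m+[n∸m]≡n c≤d) ⟩
  ∏< c f · ∏< d f ∎
  where open ≡-Reasoning

foldMap-interval : ∀ (f : ℕ → Sign) {c d} → c ≤ d → Sign-Prod.foldMap f (interval c d) ≡ ∏< c f · ∏< d f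
foldMap-interval f {c} {d} c≤d =
  trans (Sign-Prod.foldMap-map f (c +_) (upTo (d ∸ c))) (trans (Sign-Prod.foldMap-upTo _ (d ∸ c)) (∏<-interval f c≤d))

nxt-< : ∀ {n k} → suc k < n → nxt n k ≡ suc k
nxt-< {n} {k} k+1<n rewrite ≡ᵇ-false {suc k} {n} (ℕ.<⇒≢ k+1<n) = refl

nxt-last : ∀ {n k} → suc k ≡ n → nxt n k ≡ 0
nxt-last {n} {k} k+1≡n rewrite ≡ᵇ-true k+1≡n = refl

sgn-lin-< : ∀ {x y} → x < y → sgn (lin x y) ≡ plus
sgn-lin-< x<y rewrite <ᵇ-true x<y = refl

-- When l is the last label the two factors z_k - z_0 and z_{k+1} - z_0 both
-- carry a minus sign, which cancel.
sgn-uZ : ∀ {n k l} → ChordBounds n k l → sgn (uZ n k l) ≡ plus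
sgn-uZ {n} {k} {l} c@(chordBounds k<l l<n _ _) with ℕ.<-cmp (suc l) n
... | tri< l+1<n _ _
  rewrite nxt-< (ℕ.<-trans (s≤s k<l) l+1<n) | nxt-< l+1<n
        | sgn-lin-< (ℕ.m<n⇒m<1+n k<l) | sgn-lin-< (suc-<-of-chord c) | sgn-lin-< k<l = refl
... | tri≈ _ l+1≡n _
  rewrite nxt-< (ℕ.<-≤-trans (s≤s k<l) (ℕ.≤-reflexive l+1≡n)) | nxt-last l+1≡n
        | sgn-lin-< (suc-<-of-chord c) | sgn-lin-< k<l = refl
... | tri> _ _ n<l+1 = ⊥-elim (ℕ.<-irrefl refl (ℕ.<-≤-trans n<l+1 l<n))

Exponents : Set
Exponents = ℕ → ℕ → ℤ

ex-foldr-mulZ : (f : ℕ × ℕ → ZMon) (cs : List (ℕ × ℕ)) → ∀ a b →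
  ex (foldr (λ c m → mulZ (f c) m) oneZ cs) a b ≡ ℤ-Sum.foldMap (λ c → ex (f c) a b) cs
ex-foldr-mulZ f []       a b = refl
ex-foldr-mulZ f (c ∷ cs) a b = cong (λ r → ex (f c) a b ℤ.+ r) (ex-foldr-mulZ f cs a b)

sgn-foldr-mulZ : (f : ℕ × ℕ → ZMon) (cs : List (ℕ × ℕ)) →
  sgn (foldr (λ c m → mulZ (f c) m) oneZ cs) ≡ Sign-Prod.foldMap (sgn ∘ f) cs
sgn-foldr-mulZ f []       = refl
sgn-foldr-mulZ f (c ∷ cs) = cong (sgn (f c) ·_) (sgn-foldr-mulZ f cs)

uPow : ℕ → Exponents → ℕ × ℕ → ZMon
uPow n e (i , j) = powZ (uZ n i j) (e i j)

ex-uMon : ∀ n ε (e : Exponents) a b → ex (uMon n ε e) a b ≡ ℤ-Sum.∑ᶜ n (λ i j → e i j ℤ.* ex (uZ n i j) a b)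
ex-uMon n ε e a b = trans (ℤ.+-identityˡ _) (trans (ex-foldr-mulZ (uPow n e) (chords n) a b) (ℤ-Sum.foldMap-chords n _))

sgn-uMon : ∀ n ε (e : Exponents) → sgn (uMon n ε e) ≡ ε
sgn-uMon n ε e = begin
  sgn (uMon n ε e)
    ≡⟨ cong (ε ·_) (sgn-foldr-mulZ (uPow n e) (chords n)) ⟩
  ε · Sign-Prod.foldMap (sgn ∘ uPow n e) (chords n)
    ≡⟨ cong (ε ·_) (trans (Sign-Prod.foldMap-chords n _) (Sign-Prod.∑ᶜ-cong n uZ-positive)) ⟩
  ε · Sign-Prod.∑ᶜ n (λ _ _ → plus)
    ≡⟨ cong (ε ·_) (Sign-Prod.∑ᶜ-ε n) ⟩
  ε · plus
    ≡⟨ ·-identityʳ ε ⟩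
  ε ∎
  where
    open ≡-Reasoning
    uZ-positive : ∀ i j → isChordᵇ n i j ≡ true → powS (sgn (uZ n i j)) (e i j) ≡ plus
    uZ-positive i j c = trans (cong (λ σ → powS σ (e i j)) (sgn-uZ {n} {i} {j} (chord-elim c))) (powS-plus (e i j))

evalSign-∑ᶜ : ∀ n s ε (e : Exponents) → evalSign n s ε e ≡ ε · Sign-Prod.∑ᶜ n (λ i j → powS (s i j) (e i j))
evalSign-∑ᶜ n s ε e = cong (ε ·_) (trans (Sign-Prod.foldMap-map id sign (chords n)) (Sign-Prod.foldMap-chords n sign))
  where
    sign : ℕ × ℕ → Sign
    sign (i , j) = powS (s i j) (e i j)

length≡foldMap : {B : Set} (xs : List B) → length xs ≡ ℕ-Sum.foldMap (λ _ → 1) xs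
length≡foldMap []       = refl
length≡foldMap (x ∷ xs) = cong suc (length≡foldMap xs)

N-∑ᶜ : ∀ n s → N n s ≡ ℕ-Sum.∑ᶜ n (λ i j → χ⁻ (s i j))
N-∑ᶜ n s = trans (length≡foldMap (filterᵇ negative (chords n)))
                 (trans (ℕ-Sum.foldMap-filter _ negative (chords n)) (ℕ-Sum.foldMap-chords n (χ⁻ ∘ sign)))
  where
    sign : ℕ × ℕ → Sign
    sign (i , j) = s i j
    negative : ℕ × ℕ → Bool
    negative = isMinus ∘ sign

-- Transport

row : ℕ → (ℕ → ℤ) → Exponents
row r v i j = if i ≡ᵇ r then v j else 0ℤ

single : ℕ → ℕ → ℤ → Exponents
single p q k = row p (λ j → if j ≡ᵇ q then k else 0ℤ)

_⊕_ : Exponents → Exponents → Exponents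
(e ⊕ e′) i j = e i j ℤ.+ e′ i j
infixr 5 _⊕_

row-elsewhere : ∀ r v {i} j → i ≢ r → row r v i j ≡ 0ℤ
row-elsewhere r v j i≢r rewrite ≡ᵇ-false i≢r = refl

single-elsewhere : ∀ p q k {i} j → i ≢ p → single p q k i j ≡ 0ℤ
single-elsewhere p q k = row-elsewhere p (λ j → if j ≡ᵇ q then k else 0ℤ)

⊕-vanishes : ∀ (e e′ : Exponents) i j → e i j ≡ 0ℤ → e′ i j ≡ 0ℤ → (e ⊕ e′) i j ≡ 0ℤ
⊕-vanishes e e′ i j e≡0 e′≡0 rewrite e≡0 | e′≡0 = refl

-- Φ e = ∑_{chords ij} φ_ij(e_ij) covers both the exponent of z_a − z_b in ∏ u_ij^{e_ij} and the sign
-- ∏ s(u_ij)^{e_ij}.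
module ExponentSum {A : Set} {_∙_ : A → A → A} {ε : A}
  (isCommutativeMonoid : Structures.IsCommutativeMonoid {A = A} _≡_ _∙_ ε)
  (n : ℕ) (φ : ℕ → ℕ → ℤ → A) (φ-0 : ∀ i j → φ i j 0ℤ ≡ ε) where

  open Structures.IsCommutativeMonoid isCommutativeMonoid using (identityˡ; identityʳ)
  open FiniteSum isCommutativeMonoid

  Φ : Exponents → A
  Φ e = ∑ᶜ n (λ i j → φ i j (e i j))

  Φ-⊕ : ∀ p (e e′ : Exponents) → (∀ i j → i ≢ p → e i j ≡ 0ℤ) → (∀ j → e′ p j ≡ 0ℤ) →
    Φ (e ⊕ e′) ≡ Φ e ∙ Φ e′
  Φ-⊕ p e e′ e-on-p e′-off-p = trans (∑ᶜ-cong n λ i j _ → φ-split i j) (∑ᶜ-∙ n _ _)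
    where
      φ-split : ∀ i j → φ i j (e i j ℤ.+ e′ i j) ≡ φ i j (e i j) ∙ φ i j (e′ i j)
      φ-split i j with i ℕ.≟ p
      ... | yes refl rewrite e′-off-p j | ℤ.+-identityʳ (e i j) | φ-0 i j = sym (identityʳ _)
      ... | no  i≢p  rewrite e-on-p i j i≢p | ℤ.+-identityˡ (e′ i j) | φ-0 i j = sym (identityˡ _)

  Φ-row : ∀ r v → r < n → Φ (row r v) ≡ ∑ᶜ-row n r (λ j → φ r j (v j))
  Φ-row r v r<n = trans (∑<-single n r _ r<n λ i _ i≢r → ∑<-ε n λ j _ → offRow i j i≢r)
                          (∑<-cong n λ j _ → cong (λ x → if isChordᵇ n r j then φ r j x else ε) (onRow j))
    where
      offRow : ∀ i j → i ≢ r → (if isChordᵇ n i j then φ i j (row r v i j) else ε) ≡ ε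
      offRow i j i≢r rewrite row-elsewhere r v j i≢r | φ-0 i j with isChordᵇ n i j
      ... | true  = refl
      ... | false = refl
      onRow : ∀ j → row r v r j ≡ v j
      onRow j rewrite ≡ᵇ-refl r = refl

  Φ-single : ∀ p q k → isChordᵇ n p q ≡ true → Φ (single p q k) ≡ φ p q k
  Φ-single p q k c = trans (Φ-row p _ (ℕ.<-trans p<q q<n)) (trans (∑<-single n q _ q<n offColumn) onChord)
    where
      open ChordBounds (chord-elim {n} {p} {q} c) renaming (i<j to p<q; j<n to q<n)
      offColumn : ∀ j → j < n → j ≢ q → (if isChordᵇ n p j then φ p j (if j ≡ᵇ q then k else 0ℤ) else ε) ≡ ε
      offColumn j _ j≢q rewrite ≡ᵇ-false j≢q | φ-0 p j with isChordᵇ n p j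
      ... | true  = refl
      ... | false = refl
      onChord : (if isChordᵇ n p q then φ p q (if q ≡ᵇ q then k else 0ℤ) else ε) ≡ φ p q k
      onChord rewrite c | ≡ᵇ-refl q = refl

  Φ-three-singles : ∀ p₁ q₁ p₂ q₂ p₃ q₃ → p₁ ≢ p₂ → p₁ ≢ p₃ → p₂ ≢ p₃ →
    isChordᵇ n p₁ q₁ ≡ true → isChordᵇ n p₂ q₂ ≡ true → isChordᵇ n p₃ q₃ ≡ true →
    Φ (single p₁ q₁ 1ℤ ⊕ single p₂ q₂ 1ℤ ⊕ single p₃ q₃ 1ℤ) ≡ φ p₁ q₁ 1ℤ ∙ (φ p₂ q₂ 1ℤ ∙ φ p₃ q₃ 1ℤ)
  Φ-three-singles p₁ q₁ p₂ q₂ p₃ q₃ p₁≢p₂ p₁≢p₃ p₂≢p₃ c₁ c₂ c₃ = begin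
    Φ (single p₁ q₁ 1ℤ ⊕ single p₂ q₂ 1ℤ ⊕ single p₃ q₃ 1ℤ)
      ≡⟨ Φ-⊕ p₁ _ _ (λ _ j → single-elsewhere p₁ q₁ 1ℤ j)
                    (λ j → ⊕-vanishes (single p₂ q₂ 1ℤ) (single p₃ q₃ 1ℤ) p₁ j
                                      (single-elsewhere p₂ q₂ 1ℤ j p₁≢p₂) (single-elsewhere p₃ q₃ 1ℤ j p₁≢p₃)) ⟩
    Φ (single p₁ q₁ 1ℤ) ∙ Φ (single p₂ q₂ 1ℤ ⊕ single p₃ q₃ 1ℤ)
      ≡⟨ cong (Φ (single p₁ q₁ 1ℤ) ∙_) (Φ-⊕ p₂ _ _ (λ _ j → single-elsewhere p₂ q₂ 1ℤ j)
                                                      (λ j → single-elsewhere p₃ q₃ 1ℤ j p₂≢p₃)) ⟩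
    Φ (single p₁ q₁ 1ℤ) ∙ (Φ (single p₂ q₂ 1ℤ) ∙ Φ (single p₃ q₃ 1ℤ))
      ≡⟨ cong₂ _∙_ (Φ-single p₁ q₁ 1ℤ c₁) (cong₂ _∙_ (Φ-single p₂ q₂ 1ℤ c₂) (Φ-single p₃ q₃ 1ℤ c₃)) ⟩
    φ p₁ q₁ 1ℤ ∙ (φ p₂ q₂ 1ℤ ∙ φ p₃ q₃ 1ℤ) ∎
    where open ≡-Reasoning

module LinExponent (n a b : ℕ) =
  ExponentSum ℤ.+-0-isCommutativeMonoid n (λ i j k → k ℤ.* ex (uZ n i j) a b) (λ i j → ℤ.*-zeroˡ (ex (uZ n i j) a b))

module PatternSign (n : ℕ) (s : SignPattern) =
  ExponentSum ·-isCommutativeMonoid n (λ i j k → powS (s i j) k) (λ _ _ → refl)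

module Transport {n : ℕ} {s : SignPattern} {α : Ordering} {t : SignPattern} (transported : IsTransport n s α t) where

  transport-sign : ∀ {p q U} → isChordᵇ n p q ≡ true → uα n α p q ≡ U → (e : Exponents) →
    (∀ a b → LinExponent.Φ n a b e ≡ ex U a b) →
    t p q ≡ sgn U · PatternSign.Φ n s e
  transport-sign {p} {q} {U} c refl e exponents =
    trans (transported p q (≡true⇒T c) (sgn U) e
             (sgn-uMon n (sgn U) e , λ a b _ _ → trans (ex-uMon n (sgn U) e a b) (exponents a b)))
          (evalSign-∑ᶜ n s (sgn U) e)

  transport-single : ∀ {p q U} → isChordᵇ n p q ≡ true → uα n α p q ≡ U →
    ∀ p′ q′ → isChordᵇ n p′ q′ ≡ true → (k : ℤ) →
    (∀ a b → k ℤ.* ex (uZ n p′ q′) a b ≡ ex U a b) →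
    t p q ≡ sgn U · powS (s p′ q′) k
  transport-single {U = U} c uα≡U p′ q′ c′ k exponents =
    trans (transport-sign c uα≡U (single p′ q′ k) λ a b → trans (LinExponent.Φ-single n a b p′ q′ k c′) (exponents a b))
          (cong (sgn U ·_) (PatternSign.Φ-single n s p′ q′ k c′))

  transport-three-singles : ∀ {p q U} → isChordᵇ n p q ≡ true → uα n α p q ≡ U → ∀ p₁ q₁ p₂ q₂ p₃ q₃ →
    p₁ ≢ p₂ → p₁ ≢ p₃ → p₂ ≢ p₃ →
    isChordᵇ n p₁ q₁ ≡ true → isChordᵇ n p₂ q₂ ≡ true → isChordᵇ n p₃ q₃ ≡ true →
    (∀ a b → ex (uZ n p₁ q₁) a b ℤ.+ (ex (uZ n p₂ q₂) a b ℤ.+ ex (uZ n p₃ q₃) a b) ≡ ex U a b) →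
    t p q ≡ sgn U · (s p₁ q₁ · (s p₂ q₂ · s p₃ q₃))
  transport-three-singles {U = U} c uα≡U p₁ q₁ p₂ q₂ p₃ q₃ p₁≢p₂ p₁≢p₃ p₂≢p₃ c₁ c₂ c₃ exponents =
    trans (transport-sign c uα≡U e λ a b →
             trans (LinExponent.Φ-three-singles n a b p₁ q₁ p₂ q₂ p₃ q₃ p₁≢p₂ p₁≢p₃ p₂≢p₃ c₁ c₂ c₃)
                   (trans (unit a b) (exponents a b)))
          (cong (sgn U ·_) (PatternSign.Φ-three-singles n s p₁ q₁ p₂ q₂ p₃ q₃ p₁≢p₂ p₁≢p₃ p₂≢p₃ c₁ c₂ c₃))
    where
      e : Exponents
      e = single p₁ q₁ 1ℤ ⊕ single p₂ q₂ 1ℤ ⊕ single p₃ q₃ 1ℤ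
      unit : ∀ a b → 1ℤ ℤ.* ex (uZ n p₁ q₁) a b ℤ.+ (1ℤ ℤ.* ex (uZ n p₂ q₂) a b ℤ.+ 1ℤ ℤ.* ex (uZ n p₃ q₃) a b)
                   ≡ ex (uZ n p₁ q₁) a b ℤ.+ (ex (uZ n p₂ q₂) a b ℤ.+ ex (uZ n p₃ q₃) a b)
      unit a b = cong₂ ℤ._+_ (ℤ.*-identityˡ (ex (uZ n p₁ q₁) a b))
                            (cong₂ ℤ._+_ (ℤ.*-identityˡ (ex (uZ n p₂ q₂) a b)) (ℤ.*-identityˡ (ex (uZ n p₃ q₃) a b)))

module CrossExponent (a b : ℕ) where

  ℓ : ℕ → ℕ → ℤ
  ℓ x y = ex (lin x y) a b

  X : ℕ → ℕ → ℕ → ℕ → ℤ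
  X i j k l = ex (cross i j k l) a b

  ℓ-sym : ∀ x y → ℓ x y ≡ ℓ y x
  ℓ-sym x y with ℕ.<-cmp x y
  ... | tri< x<y _ _ rewrite <ᵇ-true x<y | <ᵇ-false (ℕ.<⇒≤ x<y) = refl
  ... | tri≈ _ refl _ = refl
  ... | tri> _ _ y<x rewrite <ᵇ-true y<x | <ᵇ-false (ℕ.<⇒≤ y<x) = refl

  X-flip : ∀ i j k l → X j i l k ≡ X i j k l
  X-flip i j k l = identity (ℓ j l) (ℓ i k) (ℓ j k) (ℓ i l)
    where
      identity : ∀ A B C D → (A ℤ.+ B) ℤ.- (C ℤ.+ D) ≡ (B ℤ.+ A) ℤ.- (D ℤ.+ C)
      identity = solve-∀

  X-invˡ : ∀ i j k l → -1ℤ ℤ.* X i j k l ≡ X j i k l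
  X-invˡ i j k l = identity (ℓ i k) (ℓ j l) (ℓ i l) (ℓ j k)
    where
      identity : ∀ A B C D → -1ℤ ℤ.* ((A ℤ.+ B) ℤ.- (C ℤ.+ D)) ≡ (D ℤ.+ C) ℤ.- (B ℤ.+ A)
      identity = solve-∀

  X-chainˡ : ∀ i j h k l → X i j k l ℤ.+ X j h k l ≡ X i h k l
  X-chainˡ i j h k l = identity (ℓ i k) (ℓ j l) (ℓ i l) (ℓ j k) (ℓ h l) (ℓ h k)
    where
      identity : ∀ A B C D E F → ((A ℤ.+ B) ℤ.- (C ℤ.+ D)) ℤ.+ ((D ℤ.+ E) ℤ.- (B ℤ.+ F)) ≡ (A ℤ.+ E) ℤ.- (C ℤ.+ F)
      identity = solve-∀

  X-chainʳ : ∀ i j h k l → X i j k l ℤ.+ X i j h k ≡ X i j h l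
  X-chainʳ i j h k l = identity (ℓ i k) (ℓ j l) (ℓ i l) (ℓ j k) (ℓ i h) (ℓ j h)
    where
      identity : ∀ A B C D E F → ((A ℤ.+ B) ℤ.- (C ℤ.+ D)) ℤ.+ ((E ℤ.+ D) ℤ.- (A ℤ.+ F)) ≡ (E ℤ.+ B) ℤ.- (C ℤ.+ F)
      identity = solve-∀

  X-pairSym : ∀ i j k l → X k l i j ≡ X i j k l
  X-pairSym i j k l rewrite ℓ-sym k i | ℓ-sym l j | ℓ-sym k j | ℓ-sym l i =
    identity (ℓ i k) (ℓ j l) (ℓ j k) (ℓ i l)
    where
      identity : ∀ A B C D → (A ℤ.+ B) ℤ.- (C ℤ.+ D) ≡ (A ℤ.+ B) ℤ.- (D ℤ.+ C)
      identity = solve-∀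

  X-rotate : ∀ i j k l → X i j k l ℤ.+ X j k i l ≡ X i k j l
  X-rotate i j k l rewrite ℓ-sym j i | ℓ-sym k i | ℓ-sym k j =
    identity (ℓ i k) (ℓ j l) (ℓ i l) (ℓ j k) (ℓ i j) (ℓ k l)
    where
      identity : ∀ A B C D E F → ((A ℤ.+ B) ℤ.- (C ℤ.+ D)) ℤ.+ ((E ℤ.+ F) ℤ.- (B ℤ.+ A)) ≡ (E ℤ.+ F) ℤ.- (C ℤ.+ D)
      identity = solve-∀

  X-telescope : ∀ i j c M → ℤ-Sum.∑< M (λ k → X i j (suc (c + k)) (c + k)) ≡ X i j (c + M) c
  X-telescope i j c zero rewrite ℕ.+-identityʳ c = sym (ℤ.+-inverseʳ (ℓ i c ℤ.+ ℓ j c))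
  X-telescope i j c (suc M) = begin
    ℤ-Sum.∑< (suc M) (λ k → X i j (suc (c + k)) (c + k))
      ≡⟨ ℤ-Sum.∑<-sucʳ M _ ⟩
    ℤ-Sum.∑< M (λ k → X i j (suc (c + k)) (c + k)) ℤ.+ X i j (suc (c + M)) (c + M)
      ≡⟨ cong (ℤ._+ X i j (suc (c + M)) (c + M)) (X-telescope i j c M) ⟩
    X i j (c + M) c ℤ.+ X i j (suc (c + M)) (c + M)
      ≡⟨ X-chainʳ i j (suc (c + M)) (c + M) c ⟩
    X i j (suc (c + M)) c
      ≡⟨ cong (λ h → X i j h c) (sym (ℕ.+-suc c M)) ⟩
    X i j (c + suc M) c ∎
    where open ≡-Reasoning

cross-cong : ∀ {i j k l i′ j′ k′ l′} → i ≡ i′ → j ≡ j′ → k ≡ k′ → l ≡ l′ → cross i j k l ≡ cross i′ j′ k′ l′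
cross-cong refl refl refl refl = refl

swap13-fixed : ∀ {x} → 3 ≤ x → swap13 x ≡ x
swap13-fixed {suc (suc (suc x))} _ = refl
swap13-fixed {1} (s≤s ())
swap13-fixed {2} (s≤s (s≤s ()))

nxt-mid : ∀ m {k} → k ≤ 1 + m → nxt (6 + m) (3 + k) ≡ 4 + k
nxt-mid m {k} k≤ = nxt-< {6 + m} {3 + k} (ℕ.+-monoʳ-< 4 (s≤s k≤))

nxt-final : ∀ m → nxt (6 + m) (5 + m) ≡ 0
nxt-final m = nxt-last {6 + m} {5 + m} refl

-1ℤ-except : ℕ → ℕ → ℤ
-1ℤ-except q j = if j ≡ᵇ q then 0ℤ else -1ℤ

-- The exponents of u^α_{2L} = [03|2L] = u_{2L} · ∏_{3 ≤ j < L} u_{0j}⁻¹ · ∏_{3 ≤ j < L} u_{1j}⁻¹.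
inverse-rows : ℕ → Exponents
inverse-rows m = row 0 (-1ℤ-except 2) ⊕ row 1 (-1ℤ-except (5 + m)) ⊕ single 2 (5 + m) 1ℤ

module PolygonExponentSum {A : Set} {_∙_ : A → A → A} {ε : A}
  (isCommutativeMonoid : Structures.IsCommutativeMonoid {A = A} _≡_ _∙_ ε)
  (m : ℕ) (φ : ℕ → ℕ → ℤ → A) (φ-0 : ∀ i j → φ i j 0ℤ ≡ ε) where

  open Structures.IsCommutativeMonoid isCommutativeMonoid using (identityˡ; identityʳ)
  open FiniteSum isCommutativeMonoid
  open ExponentSum isCommutativeMonoid (6 + m) φ φ-0 public

  Φ-row-0 : Φ (row 0 (λ _ → 1ℤ)) ≡ φ 0 2 1ℤ ∙ ∑< (2 + m) (λ k → φ 0 (3 + k) 1ℤ)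
  Φ-row-0 = trans (Φ-row 0 (λ _ → 1ℤ) (s≤s z≤n)) (∑ᶜ-row-0 m (λ j → φ 0 j 1ℤ))

  Φ-row-1 : Φ (row 1 (λ _ → 1ℤ)) ≡ ∑< (2 + m) (λ k → φ 1 (3 + k) 1ℤ) ∙ φ 1 (5 + m) 1ℤ
  Φ-row-1 = trans (Φ-row 1 (λ _ → 1ℤ) (s≤s (s≤s z≤n))) (∑ᶜ-row-1 m (λ j → φ 1 j 1ℤ))

  Φ-inverse-rows : Φ (inverse-rows m) ≡
    ∑< (2 + m) (λ k → φ 0 (3 + k) -1ℤ) ∙ (∑< (2 + m) (λ k → φ 1 (3 + k) -1ℤ) ∙ φ 2 (5 + m) 1ℤ)
  Φ-inverse-rows = begin
    Φ (row 0 v₀ ⊕ row 1 v₁ ⊕ single 2 (5 + m) 1ℤ)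
      ≡⟨ Φ-⊕ 0 (row 0 v₀) (row 1 v₁ ⊕ single 2 (5 + m) 1ℤ) (λ _ j → row-elsewhere 0 v₀ j) (λ _ → refl) ⟩
    Φ (row 0 v₀) ∙ Φ (row 1 v₁ ⊕ single 2 (5 + m) 1ℤ)
      ≡⟨ cong (Φ (row 0 v₀) ∙_) (Φ-⊕ 1 (row 1 v₁) (single 2 (5 + m) 1ℤ) (λ _ j → row-elsewhere 1 v₁ j) (λ _ → refl)) ⟩
    Φ (row 0 v₀) ∙ (Φ (row 1 v₁) ∙ Φ (single 2 (5 + m) 1ℤ))
      ≡⟨ cong₂ _∙_ row-0 (cong₂ _∙_ row-1 (Φ-single 2 (5 + m) 1ℤ (chord-from-2 m ℕ.≤-refl))) ⟩
    ∑< (2 + m) (λ k → φ 0 (3 + k) -1ℤ) ∙ (∑< (2 + m) (λ k → φ 1 (3 + k) -1ℤ) ∙ φ 2 (5 + m) 1ℤ) ∎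
    where
      open ≡-Reasoning
      v₀ v₁ : ℕ → ℤ
      v₀ = -1ℤ-except 2
      v₁ = -1ℤ-except (5 + m)
      row-0 : Φ (row 0 v₀) ≡ ∑< (2 + m) (λ k → φ 0 (3 + k) -1ℤ)
      row-0 = trans (Φ-row 0 v₀ (s≤s z≤n))
                    (trans (∑ᶜ-row-0 m (λ j → φ 0 j (v₀ j)))
                           (trans (cong (_∙ ∑< (2 + m) (λ k → φ 0 (3 + k) -1ℤ)) (φ-0 0 2)) (identityˡ _)))
      row-1 : Φ (row 1 v₁) ≡ ∑< (2 + m) (λ k → φ 1 (3 + k) -1ℤ)
      row-1 = trans (Φ-row 1 v₁ (s≤s (s≤s z≤n)))
                    (trans (∑ᶜ-row-1 m (λ j → φ 1 j (v₁ j)))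
                           (trans (cong₂ _∙_ (∑<-cong (2 + m) {λ k → φ 1 (3 + k) (v₁ (3 + k))} λ k k< →
                                                cong (φ 1 (3 + k)) (if-false (≡ᵇ-false (before-last k<))))
                                             (trans (cong (φ 1 (5 + m)) (if-true (≡ᵇ-refl (5 + m)))) (φ-0 1 (5 + m))))
                                  (identityʳ _)))
        where
          before-last : ∀ {k} → k < 2 + m → 3 + k ≢ 5 + m
          before-last k< eq = ℕ.<-irrefl (ℕ.+-cancelˡ-≡ 3 _ _ eq) k<

module Swap13Transport (m : ℕ) {s t : SignPattern} (transported : IsTransport (6 + m) s swap13 t) where

  module LinExp (a b : ℕ) =
    PolygonExponentSum ℤ.+-0-isCommutativeMonoid m (λ i j k → k ℤ.* ex (uZ (6 + m) i j) a b)
                       (λ i j → ℤ.*-zeroˡ (ex (uZ (6 + m) i j) a b))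
  module PatSign = PolygonExponentSum ·-isCommutativeMonoid m (λ i j k → powS (s i j) k) (λ _ _ → refl)
  open Transport {6 + m} {s} {swap13} {t} transported

  uα-≡ : ∀ p q {p′ q′} → nxt (6 + m) p ≡ p′ → nxt (6 + m) q ≡ q′ →
    uα (6 + m) swap13 p q ≡ cross (swap13 p) (swap13 p′) (swap13 q′) (swap13 q)
  uα-≡ p q refl refl = refl

  ex-uZ : ∀ a b p q {p′ q′} → nxt (6 + m) p ≡ p′ → nxt (6 + m) q ≡ q′ →
    ex (uZ (6 + m) p q) a b ≡ CrossExponent.X a b p p′ q′ q
  ex-uZ a b p q refl refl = refl

  ∑-middle : ∀ a b p {p′} → nxt (6 + m) p ≡ p′ →
    ℤ-Sum.∑< (2 + m) (λ k → 1ℤ ℤ.* ex (uZ (6 + m) p (3 + k)) a b) ≡ CrossExponent.X a b p p′ (5 + m) 3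
  ∑-middle a b p {p′} p≡ =
    trans (ℤ-Sum.∑<-cong (2 + m) λ k k< → trans (ℤ.*-identityˡ _) (ex-uZ a b p (3 + k) p≡ (nxt-mid m (ℕ.≤-pred k<))))
          (X-telescope p p′ 3 (2 + m))
    where open CrossExponent a b

  ∑-middle⁻¹ : ∀ a b p {p′} → nxt (6 + m) p ≡ p′ →
    ℤ-Sum.∑< (2 + m) (λ k → -1ℤ ℤ.* ex (uZ (6 + m) p (3 + k)) a b) ≡ CrossExponent.X a b p′ p (5 + m) 3
  ∑-middle⁻¹ a b p {p′} p≡ =
    trans (ℤ-Sum.∑<-cong (2 + m) λ k k< → trans (cong (-1ℤ ℤ.*_) (ex-uZ a b p (3 + k) p≡ (nxt-mid m (ℕ.≤-pred k<))))
                                               (X-invˡ p p′ (4 + k) (3 + k)))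
          (X-telescope p′ p 3 (2 + m))
    where open CrossExponent a b

  t-unmoved : ∀ {p q} → isChordᵇ (6 + m) p q ≡ true → 3 ≤ p → q ≤ 4 + m → t p q ≡ s p q
  t-unmoved {p} {q} c 3≤p q≤ =
    trans (transport-single c uα≡uZ p q c 1ℤ (λ a b → ℤ.*-identityˡ (ex (uZ (6 + m) p q) a b)))
          (cong (_· s p q) (sgn-uZ (chord-elim {6 + m} {p} {q} c)))
    where
      open ChordBounds (chord-elim {6 + m} {p} {q} c)
      fixed-next : ∀ {x} → 3 ≤ x → suc x < 6 + m → swap13 (nxt (6 + m) x) ≡ nxt (6 + m) x
      fixed-next 3≤x x+1< rewrite nxt-< x+1< = swap13-fixed (ℕ.m≤n⇒m≤1+n 3≤x)
      3≤q : 3 ≤ q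
      3≤q = ℕ.≤-trans 3≤p (ℕ.<⇒≤ i<j)
      uα≡uZ : uα (6 + m) swap13 p q ≡ uZ (6 + m) p q
      uα≡uZ = cross-cong (swap13-fixed 3≤p) (fixed-next 3≤p (ℕ.<-≤-trans (s≤s i<j) j<n))
                         (fixed-next 3≤q (s≤s (s≤s q≤))) (swap13-fixed 3≤q)

  t-row0 : ∀ {k} → k ≤ 1 + m → t 0 (3 + k) ≡ s 1 (3 + k)
  t-row0 {k} k≤ = transport-single (chord-from-0 m k≤) (uα-≡ 0 (3 + k) refl (nxt-mid m k≤))
                                   1 (3 + k) (chord-from-1 m (ℕ.m≤n⇒m≤1+n k≤)) -1ℤ exponents
    where
      exponents : ∀ a b → -1ℤ ℤ.* ex (uZ (6 + m) 1 (3 + k)) a b ≡ ex (cross 2 1 (4 + k) (3 + k)) a b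
      exponents a b = trans (cong (-1ℤ ℤ.*_) (ex-uZ a b 1 (3 + k) refl (nxt-mid m k≤))) (X-invˡ 1 2 (4 + k) (3 + k))
        where open CrossExponent a b

  t-row1 : ∀ {k} → k ≤ 1 + m → t 1 (3 + k) ≡ s 0 (3 + k)
  t-row1 {k} k≤ = transport-single (chord-from-1 m (ℕ.m≤n⇒m≤1+n k≤)) (uα-≡ 1 (3 + k) refl (nxt-mid m k≤))
                                   0 (3 + k) (chord-from-0 m k≤) -1ℤ exponents
    where
      exponents : ∀ a b → -1ℤ ℤ.* ex (uZ (6 + m) 0 (3 + k)) a b ≡ ex (cross 1 0 (4 + k) (3 + k)) a b
      exponents a b = trans (cong (-1ℤ ℤ.*_) (ex-uZ a b 0 (3 + k) refl (nxt-mid m k≤))) (X-invˡ 0 1 (4 + k) (3 + k))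
        where open CrossExponent a b

  t-row2 : ∀ {k} → k ≤ m → t 2 (4 + k) ≡ s 0 (4 + k) · (s 1 (4 + k) · s 2 (4 + k))
  t-row2 {k} k≤ =
    transport-three-singles (chord-from-2 m (ℕ.m≤n⇒m≤1+n k≤)) (uα-≡ 2 (4 + k) refl next)
      0 (4 + k) 1 (4 + k) 2 (4 + k) (λ ()) (λ ()) (λ ())
      (chord-from-0 m (s≤s k≤)) (chord-from-1 m (s≤s (ℕ.m≤n⇒m≤1+n k≤))) (chord-from-2 m (ℕ.m≤n⇒m≤1+n k≤)) exponents
    where
      next : nxt (6 + m) (4 + k) ≡ 5 + k
      next = nxt-mid m (s≤s k≤)
      exponents : ∀ a b → ex (uZ (6 + m) 0 (4 + k)) a b ℤ.+ (ex (uZ (6 + m) 1 (4 + k)) a b ℤ.+ ex (uZ (6 + m) 2 (4 + k)) a b)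
                          ≡ ex (cross 0 3 (5 + k) (4 + k)) a b
      exponents a b = begin
        ex (uZ (6 + m) 0 (4 + k)) a b ℤ.+ (ex (uZ (6 + m) 1 (4 + k)) a b ℤ.+ ex (uZ (6 + m) 2 (4 + k)) a b)
          ≡⟨ cong₂ ℤ._+_ (ex-uZ a b 0 (4 + k) refl next)
                         (cong₂ ℤ._+_ (ex-uZ a b 1 (4 + k) refl next) (ex-uZ a b 2 (4 + k) refl next)) ⟩
        X 0 1 (5 + k) (4 + k) ℤ.+ (X 1 2 (5 + k) (4 + k) ℤ.+ X 2 3 (5 + k) (4 + k))
          ≡⟨ cong (λ x → X 0 1 (5 + k) (4 + k) ℤ.+ x) (X-chainˡ 1 2 3 (5 + k) (4 + k)) ⟩
        X 0 1 (5 + k) (4 + k) ℤ.+ X 1 3 (5 + k) (4 + k)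
          ≡⟨ X-chainˡ 0 1 3 (5 + k) (4 + k) ⟩
        X 0 3 (5 + k) (4 + k) ∎
        where
          open CrossExponent a b
          open ≡-Reasoning

  t-last : ∀ {k} → k ≤ m → t (3 + k) (5 + m) ≡ s 0 (3 + k) · (s 1 (3 + k) · s (3 + k) (5 + m))
  t-last {k} k≤ =
    trans (transport-three-singles (chord-to-last m k≤) (uα-≡ (3 + k) (5 + m) next (nxt-final m))
             0 (3 + k) 1 (3 + k) (3 + k) (5 + m) (λ ()) (λ ()) (λ ())
             (chord-from-0 m k≤′) (chord-from-1 m (ℕ.m≤n⇒m≤1+n k≤′)) (chord-to-last m k≤) exponents)
          (cong (_· (s 0 (3 + k) · (s 1 (3 + k) · s (3 + k) (5 + m)))) sign)
    where
      k≤′ : k ≤ 1 + m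
      k≤′ = ℕ.m≤n⇒m≤1+n k≤
      next : nxt (6 + m) (3 + k) ≡ 4 + k
      next = nxt-mid m k≤′
      sign : sgn (cross (3 + k) (4 + k) 2 (5 + m)) ≡ plus
      sign rewrite sgn-lin-< {4 + k} {5 + m} (ℕ.+-monoʳ-< 4 (s≤s k≤))
                 | sgn-lin-< {3 + k} {5 + m} (ℕ.+-monoʳ-< 3 (s≤s k≤′)) = refl
      exponents : ∀ a b → ex (uZ (6 + m) 0 (3 + k)) a b ℤ.+ (ex (uZ (6 + m) 1 (3 + k)) a b ℤ.+ ex (uZ (6 + m) (3 + k) (5 + m)) a b)
                          ≡ ex (cross (3 + k) (4 + k) 2 (5 + m)) a b
      exponents a b = begin
        ex (uZ (6 + m) 0 (3 + k)) a b ℤ.+ (ex (uZ (6 + m) 1 (3 + k)) a b ℤ.+ ex (uZ (6 + m) (3 + k) (5 + m)) a b)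
          ≡⟨ cong₂ ℤ._+_ (ex-uZ a b 0 (3 + k) refl next)
                         (cong₂ ℤ._+_ (ex-uZ a b 1 (3 + k) refl next) (ex-uZ a b (3 + k) (5 + m) next (nxt-final m))) ⟩
        X 0 1 j′ j ℤ.+ (X 1 2 j′ j ℤ.+ X j j′ 0 L)
          ≡⟨ sym (ℤ.+-assoc (X 0 1 j′ j) _ _) ⟩
        (X 0 1 j′ j ℤ.+ X 1 2 j′ j) ℤ.+ X j j′ 0 L
          ≡⟨ cong (ℤ._+ X j j′ 0 L) (X-chainˡ 0 1 2 j′ j) ⟩
        X 0 2 j′ j ℤ.+ X j j′ 0 L
          ≡⟨ cong (ℤ._+ X j j′ 0 L) (trans (X-pairSym j′ j 0 2) (X-flip j j′ 2 0)) ⟩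
        X j j′ 2 0 ℤ.+ X j j′ 0 L
          ≡⟨ ℤ.+-comm (X j j′ 2 0) _ ⟩
        X j j′ 0 L ℤ.+ X j j′ 2 0
          ≡⟨ X-chainʳ j j′ 2 0 L ⟩
        X j j′ 2 L ∎
        where
          open CrossExponent a b
          open ≡-Reasoning
          j j′ L : ℕ
          j = 3 + k
          j′ = 4 + k
          L = 5 + m

  t-0-2 : t 0 2 ≡ Sign-Prod.∑< (2 + m) (λ k → s 1 (3 + k)) · s 1 (5 + m)
  t-0-2 = trans (transport-sign refl (uα-≡ 0 2 refl refl) (row 1 (λ _ → 1ℤ)) exponents) PatSign.Φ-row-1
    where
      exponents : ∀ a b → LinExp.Φ a b (row 1 (λ _ → 1ℤ)) ≡ ex (cross 2 1 3 0) a b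
      exponents a b = begin
        LinExp.Φ a b (row 1 (λ _ → 1ℤ))
          ≡⟨ LinExp.Φ-row-1 a b ⟩
        ℤ-Sum.∑< (2 + m) (λ k → 1ℤ ℤ.* ex (uZ (6 + m) 1 (3 + k)) a b) ℤ.+ 1ℤ ℤ.* ex (uZ (6 + m) 1 (5 + m)) a b
          ≡⟨ cong₂ ℤ._+_ (∑-middle a b 1 refl) (trans (ℤ.*-identityˡ _) (ex-uZ a b 1 (5 + m) refl (nxt-final m))) ⟩
        X 1 2 (5 + m) 3 ℤ.+ X 1 2 0 (5 + m)
          ≡⟨ X-chainʳ 1 2 0 (5 + m) 3 ⟩
        X 1 2 0 3
          ≡⟨ X-flip 1 2 0 3 ⟨
        X 2 1 3 0 ∎
        where
          open CrossExponent a b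
          open ≡-Reasoning

  t-1-last : t 1 (5 + m) ≡ s 0 2 · Sign-Prod.∑< (2 + m) (λ k → s 0 (3 + k))
  t-1-last = trans (transport-sign (chord-from-1 m ℕ.≤-refl) (uα-≡ 1 (5 + m) refl (nxt-final m)) (row 0 (λ _ → 1ℤ)) exponents)
                   PatSign.Φ-row-0
    where
      exponents : ∀ a b → LinExp.Φ a b (row 0 (λ _ → 1ℤ)) ≡ ex (cross 1 0 2 (5 + m)) a b
      exponents a b = begin
        LinExp.Φ a b (row 0 (λ _ → 1ℤ))
          ≡⟨ LinExp.Φ-row-0 a b ⟩
        1ℤ ℤ.* X 0 1 3 2 ℤ.+ ℤ-Sum.∑< (2 + m) (λ k → 1ℤ ℤ.* ex (uZ (6 + m) 0 (3 + k)) a b)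
          ≡⟨ cong₂ ℤ._+_ (ℤ.*-identityˡ (X 0 1 3 2)) (∑-middle a b 0 refl) ⟩
        X 0 1 3 2 ℤ.+ X 0 1 (5 + m) 3
          ≡⟨ X-chainʳ 0 1 (5 + m) 3 2 ⟩
        X 0 1 (5 + m) 2
          ≡⟨ X-flip 0 1 (5 + m) 2 ⟨
        X 1 0 2 (5 + m) ∎
        where
          open CrossExponent a b
          open ≡-Reasoning

  t-2-last : t 2 (5 + m) ≡ minus · (Sign-Prod.∑< (2 + m) (λ k → s 0 (3 + k)) ·
                                    (Sign-Prod.∑< (2 + m) (λ k → s 1 (3 + k)) · s 2 (5 + m)))
  t-2-last = trans (transport-sign (chord-from-2 m ℕ.≤-refl) (uα-≡ 2 (5 + m) refl (nxt-final m)) (inverse-rows m) exponents)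
                   (cong (minus ·_) PatSign.Φ-inverse-rows)
    where
      exponents : ∀ a b → LinExp.Φ a b (inverse-rows m) ≡ ex (cross 0 3 2 (5 + m)) a b
      exponents a b = begin
        LinExp.Φ a b (inverse-rows m)
          ≡⟨ LinExp.Φ-inverse-rows a b ⟩
        ℤ-Sum.∑< (2 + m) (λ k → -1ℤ ℤ.* ex (uZ (6 + m) 0 (3 + k)) a b) ℤ.+
          (ℤ-Sum.∑< (2 + m) (λ k → -1ℤ ℤ.* ex (uZ (6 + m) 1 (3 + k)) a b) ℤ.+ 1ℤ ℤ.* ex (uZ (6 + m) 2 (5 + m)) a b)
          ≡⟨ cong₂ ℤ._+_ (∑-middle⁻¹ a b 0 refl)
                         (cong₂ ℤ._+_ (∑-middle⁻¹ a b 1 refl)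
                                      (trans (ℤ.*-identityˡ _) (ex-uZ a b 2 (5 + m) refl (nxt-final m)))) ⟩
        X 1 0 L 3 ℤ.+ (X 2 1 L 3 ℤ.+ X 2 3 0 L)
          ≡⟨ sym (ℤ.+-assoc (X 1 0 L 3) _ _) ⟩
        (X 1 0 L 3 ℤ.+ X 2 1 L 3) ℤ.+ X 2 3 0 L
          ≡⟨ cong (ℤ._+ X 2 3 0 L) (trans (ℤ.+-comm (X 1 0 L 3) _) (X-chainˡ 2 1 0 L 3)) ⟩
        X 2 0 L 3 ℤ.+ X 2 3 0 L
          ≡⟨ cong (ℤ._+ X 2 3 0 L) (X-flip 0 2 3 L) ⟩
        X 0 2 3 L ℤ.+ X 2 3 0 L
          ≡⟨ X-rotate 0 2 3 L ⟩
        X 0 3 2 L ∎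
        where
          open CrossExponent a b
          open ≡-Reasoning
          L : ℕ
          L = 5 + m

-- Consistency

NotBothMinus : Sign → Sign → Set
NotBothMinus σ τ = ¬ (σ ≡ minus × τ ≡ minus)

notBothMinus-subst : ∀ {σ σ′ τ τ′} → σ ≡ σ′ → τ ≡ τ′ → NotBothMinus σ τ → NotBothMinus σ′ τ′
notBothMinus-subst refl refl h = h

notBothMinus-plus : ∀ {σ} → NotBothMinus σ minus → σ ≡ plus
notBothMinus-plus {plus}  _ = refl
notBothMinus-plus {minus} h = ⊥-elim (h (refl , refl))

·-minus-cases : ∀ {σ τ} → σ · τ ≡ minus → (σ ≡ minus × τ ≡ plus) ⊎ (σ ≡ plus × τ ≡ minus)
·-minus-cases {plus}  {minus} _ = inj₂ (refl , refl)
·-minus-cases {minus} {plus}  _ = inj₁ (refl , refl)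

·-pull-pair : ∀ a y b c z d → ((a · y) · b) · ((c · z) · d) ≡ ((a · b) · (c · d)) · (y · z)
·-pull-pair a y b c z d =
  trans (cong₂ _·_ (Sign-Algebra.xy∙z≈xz∙y a y b) (Sign-Algebra.xy∙z≈xz∙y c z d))
        (Sign-Algebra.interchange (a · b) y (c · d) z)

prodPairs-foldMap : ∀ s I J → prodPairs s I J ≡ Sign-Prod.foldMap (λ i → Sign-Prod.foldMap (sval s i) J) I
prodPairs-foldMap s I J = trans (Sign-Prod.foldMap-concatMap id (λ i → map (sval s i) J) I)
                                (Sign-Prod.foldMap-cong (λ i → Sign-Prod.foldMap-map id (sval s i) J) I)

-- π r c is the sign of ∏_{j<c} u_{rj}, so in the sign group the product over c ≤ j < d is π r c · π r d.
-- The monomials of the partitions used below, for a cut c: X c over {0} × [3,c), M c and P c over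
-- {1,2} × [c,n) and {1,2} × [c,L), Y c over {1} × [c,L), and W c, V c over [3,c) × {L,0}, [2,c) × {L,0}.
module Monomials (m : ℕ) (s : SignPattern) where

  π : ℕ → ℕ → Sign
  π r c = ∏< c (sval s r)

  q : ℕ → Sign
  q i = sval s i (5 + m) · sval s i 0

  twoRows : ℕ → ℕ → Sign
  twoRows d c = (π 1 c · π 1 d) · (π 2 c · π 2 d)

  X M P W Y V : ℕ → Sign
  X c = π 0 3 · π 0 c
  M = twoRows (6 + m)
  P = twoRows (5 + m)
  W c = ∏< 3 q · ∏< c q
  Y c = π 1 c · π 1 (5 + m)
  V c = ∏< 2 q · ∏< c q

  π-suc : ∀ r c → π r (suc c) ≡ π r c · sval s r c
  π-suc r c = Sign-Prod.∑<-sucʳ c (sval s r)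

  X-suc : ∀ c → X (suc c) ≡ X c · sval s 0 c
  X-suc c = trans (cong (π 0 3 ·_) (π-suc 0 c)) (sym (·-assoc (π 0 3) (π 0 c) (sval s 0 c)))

  twoRows-suc : ∀ d c → twoRows d (suc c) ≡ twoRows d c · (sval s 1 c · sval s 2 c)
  twoRows-suc d c = trans (cong₂ (λ a b → (a · π 1 d) · (b · π 2 d)) (π-suc 1 c) (π-suc 2 c))
                          (·-pull-pair (π 1 c) _ (π 1 d) (π 2 c) _ (π 2 d))

  W-suc : ∀ c → W (suc c) ≡ W c · q c
  W-suc c = trans (cong (∏< 3 q ·_) (Sign-Prod.∑<-sucʳ c q)) (sym (·-assoc (∏< 3 q) (∏< c q) (q c)))

  V-suc : ∀ c → V (suc c) ≡ V c · q c
  V-suc c = trans (cong (∏< 2 q ·_) (Sign-Prod.∑<-sucʳ c q)) (sym (·-assoc (∏< 2 q) (∏< c q) (q c)))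

  Y-suc : ∀ c → Y (suc c) ≡ Y c · sval s 1 c
  Y-suc c = trans (cong (_· π 1 (5 + m)) (π-suc 1 c)) (Sign-Algebra.xy∙z≈xz∙y (π 1 c) (sval s 1 c) (π 1 (5 + m)))

  M≡P· : ∀ c → M c ≡ P c · (s 1 (5 + m) · s 2 (5 + m))
  M≡P· c = trans (cong₂ (λ a b → (π 1 c · a) · (π 2 c · b)) (π-suc 1 (5 + m)) (π-suc 2 (5 + m)))
                 (trans (cong₂ _·_ (sym (·-assoc (π 1 c) (π 1 (5 + m)) (s 1 (5 + m))))
                                   (sym (·-assoc (π 2 c) (π 2 (5 + m)) (s 2 (5 + m)))))
                        (Sign-Algebra.interchange (π 1 c · π 1 (5 + m)) _ (π 2 c · π 2 (5 + m)) _))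

  W≡V· : ∀ c → W c ≡ V c · q 2
  W≡V· c = trans (cong (_· ∏< c q) (Sign-Prod.∑<-sucʳ 2 q)) (Sign-Algebra.xy∙z≈xz∙y (∏< 2 q) (q 2) (∏< c q))

  rows-over : ∀ i {c d} → c ≤ d → Sign-Prod.foldMap (sval s i) (interval c d ++ interval 0 0) ≡ π i c · π i d
  rows-over i {c} {d} c≤d = trans (Sign-Prod.foldMap-++ (sval s i) (interval c d) [])
                                  (trans (·-identityʳ _) (foldMap-interval (sval s i) c≤d))

  column-L0 : ∀ i → Sign-Prod.foldMap (sval s i) (interval (5 + m) (6 + m) ++ interval 0 1) ≡ q i
  column-L0 i = begin
    Sign-Prod.foldMap (sval s i) (interval (5 + m) (6 + m) ++ interval 0 1)
      ≡⟨ Sign-Prod.foldMap-++ (sval s i) (interval (5 + m) (6 + m)) (interval 0 1) ⟩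
    Sign-Prod.foldMap (sval s i) (interval (5 + m) (6 + m)) · (sval s i 0 · plus)
      ≡⟨ cong₂ _·_ (foldMap-interval (sval s i) (ℕ.n≤1+n (5 + m))) (·-identityʳ (sval s i 0)) ⟩
    (π i (5 + m) · π i (6 + m)) · sval s i 0
      ≡⟨ cong (λ σ → (π i (5 + m) · σ) · sval s i 0) (π-suc i (5 + m)) ⟩
    (π i (5 + m) · (π i (5 + m) · sval s i (5 + m))) · sval s i 0
      ≡⟨ cong (_· sval s i 0) (·-selfInverse (π i (5 + m)) _) ⟩
    q i ∎
    where open ≡-Reasoning

module Cuts (m : ℕ) (s : SignPattern) (consistent : Consistent (6 + m) s) where

  open Monomials m s

  cut-X-M : ∀ {c} → 3 < c → c ≤ 5 + m → NotBothMinus (X c) (M c)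
  cut-X-M {c} 3<c c≤ = notBothMinus-subst first second (consistent 0 1 3 c (s≤s z≤n) (s≤s (s≤s z≤n)) 3<c (s≤s c≤))
    where
      first : prodPairs s (interval 0 1) (interval 3 c) ≡ X c
      first = trans (prodPairs-foldMap s (interval 0 1) (interval 3 c))
                    (trans (·-identityʳ _) (foldMap-interval (sval s 0) (ℕ.<⇒≤ 3<c)))
      second : prodPairs s (interval 1 3) (interval c (6 + m) ++ interval 0 0) ≡ M c
      second = trans (prodPairs-foldMap s (interval 1 3) (interval c (6 + m) ++ interval 0 0))
                     (cong₂ _·_ (rows-over 1 c≤n) (trans (·-identityʳ _) (rows-over 2 c≤n)))
        where
          c≤n : c ≤ 6 + m
          c≤n = ℕ.m≤n⇒m≤1+n c≤

  cut-P-W : ∀ {c} → 3 < c → c ≤ 4 + m → NotBothMinus (P c) (W c)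
  cut-P-W {c} 3<c c≤ = notBothMinus-subst first second (consistent 1 3 c (5 + m) (s≤s (s≤s z≤n)) 3<c (s≤s c≤) (ℕ.n<1+n _))
    where
      c≤L : c ≤ 5 + m
      c≤L = ℕ.m≤n⇒m≤1+n c≤
      first : prodPairs s (interval 1 3) (interval c (5 + m)) ≡ P c
      first = trans (prodPairs-foldMap s (interval 1 3) (interval c (5 + m)))
                    (cong₂ _·_ (foldMap-interval (sval s 1) c≤L) (trans (·-identityʳ _) (foldMap-interval (sval s 2) c≤L)))
      second : prodPairs s (interval 3 c) (interval (5 + m) (6 + m) ++ interval 0 1) ≡ W c
      second = trans (prodPairs-foldMap s (interval 3 c) (interval (5 + m) (6 + m) ++ interval 0 1))
                     (trans (Sign-Prod.foldMap-cong column-L0 (interval 3 c)) (foldMap-interval q (ℕ.<⇒≤ 3<c)))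

  cut-Y-V : ∀ {c} → 2 < c → c ≤ 4 + m → NotBothMinus (Y c) (V c)
  cut-Y-V {c} 2<c c≤ = notBothMinus-subst first second (consistent 1 2 c (5 + m) (s≤s (s≤s z≤n)) 2<c (s≤s c≤) (ℕ.n<1+n _))
    where
      first : prodPairs s (interval 1 2) (interval c (5 + m)) ≡ Y c
      first = trans (prodPairs-foldMap s (interval 1 2) (interval c (5 + m)))
                    (trans (·-identityʳ _) (foldMap-interval (sval s 1) (ℕ.m≤n⇒m≤1+n c≤)))
      second : prodPairs s (interval 2 c) (interval (5 + m) (6 + m) ++ interval 0 1) ≡ V c
      second = trans (prodPairs-foldMap s (interval 2 c) (interval (5 + m) (6 + m) ++ interval 0 1))
                     (trans (Sign-Prod.foldMap-cong column-L0 (interval 2 c)) (foldMap-interval q (ℕ.<⇒≤ 2<c)))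

  cut-XY-2L : NotBothMinus (X (5 + m) · Y 3) (s 2 (5 + m))
  cut-XY-2L = notBothMinus-subst first second (consistent 0 2 3 (5 + m) (s≤s z≤n) (s≤s (s≤s (s≤s z≤n))) 3<L (ℕ.n<1+n _))
    where
      3<L : 3 < 5 + m
      3<L = s≤s (s≤s (s≤s (s≤s z≤n)))
      first : prodPairs s (interval 0 2) (interval 3 (5 + m)) ≡ X (5 + m) · Y 3
      first = trans (prodPairs-foldMap s (interval 0 2) (interval 3 (5 + m)))
                    (cong₂ _·_ (foldMap-interval (sval s 0) (ℕ.<⇒≤ 3<L))
                               (trans (·-identityʳ _) (foldMap-interval (sval s 1) (ℕ.<⇒≤ 3<L))))
      second : prodPairs s (interval 2 3) (interval (5 + m) (6 + m) ++ interval 0 0) ≡ s 2 (5 + m)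
      second = trans (prodPairs-foldMap s (interval 2 3) (interval (5 + m) (6 + m) ++ interval 0 0))
                     (trans (·-identityʳ _) (trans (rows-over 2 (ℕ.n≤1+n (5 + m)))
                            (trans (cong (π 2 (5 + m) ·_) (π-suc 2 (5 + m))) (·-selfInverse (π 2 (5 + m)) (s 2 (5 + m))))))

-- Consistency at two neighbouring cuts c and c + 1 around the label j = c, with the monomials at
-- cut c and the signs at j as variables.
neighbouring-cuts-first : ∀ P w → NotBothMinus minus (P · minus) → NotBothMinus P (w · minus) → w ≡ minus
neighbouring-cuts-first plus  w     h₁ _  = ⊥-elim (h₁ (refl , refl))
neighbouring-cuts-first minus plus  _  h₂ = ⊥-elim (h₂ (refl , refl))
neighbouring-cuts-first minus minus _  _  = refl

neighbouring-cuts-x : ∀ X P W z w → NotBothMinus X (P · minus) → NotBothMinus (X · minus) ((P · minus) · z) →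
  NotBothMinus P W → NotBothMinus (P · z) (W · (w · minus)) → z ≡ minus ⊎ w ≡ minus
neighbouring-cuts-x X     P     W     minus w     _  _  _  _  = inj₁ refl
neighbouring-cuts-x X     P     W     plus  minus _  _  _  _  = inj₂ refl
neighbouring-cuts-x plus  plus  W     plus  plus  _  h₂ _  _  = ⊥-elim (h₂ (refl , refl))
neighbouring-cuts-x minus plus  W     plus  plus  h₁ _  _  _  = ⊥-elim (h₁ (refl , refl))
neighbouring-cuts-x X     minus plus  plus  plus  _  _  _  h₄ = ⊥-elim (h₄ (refl , refl))
neighbouring-cuts-x X     minus minus plus  plus  _  _  h₃ _  = ⊥-elim (h₃ (refl , refl))

neighbouring-cuts-y : ∀ Y V P z w → NotBothMinus Y V → NotBothMinus (Y · minus) (V · (w · plus)) →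
  NotBothMinus P (V · minus) → NotBothMinus (P · (minus · z)) ((V · minus) · (w · plus)) → z ≡ minus ⊎ w ≡ minus
neighbouring-cuts-y Y     V     P     minus w     _  _  _  _  = inj₁ refl
neighbouring-cuts-y Y     V     P     plus  minus _  _  _  _  = inj₂ refl
neighbouring-cuts-y plus  minus P     plus  plus  _  h₂ _  _  = ⊥-elim (h₂ (refl , refl))
neighbouring-cuts-y minus minus P     plus  plus  h₁ _  _  _  = ⊥-elim (h₁ (refl , refl))
neighbouring-cuts-y Y     plus  minus plus  plus  _  _  h₃ _  = ⊥-elim (h₃ (refl , refl))
neighbouring-cuts-y Y     plus  plus  plus  plus  _  _  _  h₄ = ⊥-elim (h₄ (refl , refl))

neighbouring-cuts-last : ∀ Y V P z → Y · minus ≡ plus → P · (minus · z) ≡ plus →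
  NotBothMinus Y V → NotBothMinus P (V · minus) → z ≡ minus
neighbouring-cuts-last plus  V     P     z     () _  _  _
neighbouring-cuts-last minus minus P     z     _  _  h₁ _  = ⊥-elim (h₁ (refl , refl))
neighbouring-cuts-last minus plus  minus z     _  _  _  h₂ = ⊥-elim (h₂ (refl , refl))
neighbouring-cuts-last minus plus  plus  plus  _  () _  _
neighbouring-cuts-last minus plus  plus  minus _  _  _  _  = refl

sval-< : ∀ s {i j} → i < j → sval s i j ≡ s i j
sval-< s i<j rewrite <ᵇ-true i<j = refl

cycLen-wrapping-2 : ∀ m i → cycLen (6 + m) i (4 + m + i) ≡ 2
cycLen-wrapping-2 m i rewrite ℕ.m+n∸n≡m (4 + m) i | ℕ.m+n∸n≡m 2 m = refl

module ConsistencyConsequences (m : ℕ) (s : SignPattern) (consistent : Consistent (6 + m) s) (s-2-last : s 2 (5 + m) ≡ minus)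
  (short-plus : ∀ i j → IsChord (6 + m) i j → cycLen (6 + m) i j ≡ 2 → s i j ≡ plus) where

  open Monomials m s
  open Cuts m s consistent

  s-0-2 : s 0 2 ≡ plus
  s-0-2 = short-plus 0 2 tt refl

  s-1-3 : s 1 3 ≡ plus
  s-1-3 = short-plus 1 3 tt refl

  s-1-last : s 1 (5 + m) ≡ plus
  s-1-last = short-plus 1 (5 + m) (≡true⇒T (chord-from-1 m ℕ.≤-refl))
                        (subst (λ j → cycLen (6 + m) 1 j ≡ 2) (ℕ.+-comm (4 + m) 1) (cycLen-wrapping-2 m 1))

  s-0-penultimate : s 0 (4 + m) ≡ plus
  s-0-penultimate = short-plus 0 (4 + m) (≡true⇒T (chord-from-0 m ℕ.≤-refl))
                               (subst (λ j → cycLen (6 + m) 0 j ≡ 2) (ℕ.+-identityʳ (4 + m)) (cycLen-wrapping-2 m 0))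

  M≡P·minus : ∀ c → M c ≡ P c · minus
  M≡P·minus c = trans (M≡P· c) (cong₂ (λ σ τ → P c · (σ · τ)) s-1-last s-2-last)

  W≡V·minus : ∀ c → W c ≡ V c · minus
  W≡V·minus c = trans (W≡V· c) (cong₂ (λ σ τ → V c · (σ · τ)) s-2-last s-0-2)

  P-last : P (5 + m) ≡ plus
  P-last = cong₂ _·_ (·-inverse (π 1 (5 + m))) (·-inverse (π 2 (5 + m)))

  X-last : X (5 + m) ≡ plus
  X-last = notBothMinus-plus (notBothMinus-subst refl (trans (M≡P·minus (5 + m)) (cong (_· minus) P-last))
                                                  (cut-X-M (s≤s (s≤s (s≤s (s≤s z≤n)))) ℕ.≤-refl))

  Y-first : Y 3 ≡ plus
  Y-first = notBothMinus-plus (notBothMinus-subst (cong (_· Y 3) X-last) s-2-last cut-XY-2L)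

  row-0-product : ∏< (2 + m) (λ k → s 0 (3 + k)) ≡ plus
  row-0-product = trans (∏<-interval (sval s 0) {3} {5 + m} (s≤s (s≤s (s≤s z≤n)))) X-last

  row-1-product : ∏< (2 + m) (λ k → s 1 (3 + k)) ≡ plus
  row-1-product = trans (∏<-interval (sval s 1) {3} {5 + m} (s≤s (s≤s (s≤s z≤n)))) Y-first

  x-flip-first : s 0 3 ≡ minus → s 3 (5 + m) ≡ minus
  x-flip-first x₃ = trans (sym (sval-< s {3} {5 + m} (s≤s (s≤s (s≤s (s≤s z≤n))))))
                        (neighbouring-cuts-first (P 4) (sval s 3 (5 + m)) h₁ h₂)
    where
      h₁ : NotBothMinus minus (P 4 · minus)
      h₁ = notBothMinus-subst (trans (X-suc 3) (cong₂ _·_ (·-inverse (π 0 3)) x₃)) (M≡P·minus 4)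
                              (cut-X-M (ℕ.n<1+n 3) (s≤s (s≤s (s≤s (s≤s z≤n)))))
      h₂ : NotBothMinus (P 4) (sval s 3 (5 + m) · minus)
      h₂ = notBothMinus-subst refl (trans (W-suc 3) (cong₂ _·_ (·-inverse (∏< 3 q)) (cong (sval s 3 (5 + m) ·_) x₃)))
                              (cut-P-W (ℕ.n<1+n 3) (s≤s (s≤s (s≤s (s≤s z≤n)))))

  x-flip-middle : ∀ {k} → k < m → s 0 (4 + k) ≡ minus → s 1 (4 + k) ≡ plus →
    s 2 (4 + k) ≡ minus ⊎ s (4 + k) (5 + m) ≡ minus
  x-flip-middle {k} k<m x y with neighbouring-cuts-x (X j) (P j) (W j) (s 2 j) (sval s j (5 + m)) h₁ h₂ h₃ h₄
    where
      j : ℕ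
      j = 4 + k
      3<j : 3 < j
      3<j = s≤s (s≤s (s≤s (s≤s z≤n)))
      h₁ : NotBothMinus (X j) (P j · minus)
      h₁ = notBothMinus-subst refl (M≡P·minus j) (cut-X-M 3<j (ℕ.+-monoʳ-≤ 4 (ℕ.m≤n⇒m≤1+n (ℕ.<⇒≤ k<m))))
      h₂ : NotBothMinus (X j · minus) ((P j · minus) · s 2 j)
      h₂ = notBothMinus-subst (trans (X-suc j) (cong (X j ·_) x))
                              (trans (twoRows-suc (6 + m) j) (cong₂ (λ μ σ → μ · (σ · s 2 j)) (M≡P·minus j) y))
                              (cut-X-M (ℕ.m<n⇒m<1+n 3<j) (ℕ.+-monoʳ-≤ 5 (ℕ.<⇒≤ k<m)))
      h₃ : NotBothMinus (P j) (W j)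
      h₃ = cut-P-W 3<j (ℕ.+-monoʳ-≤ 4 (ℕ.<⇒≤ k<m))
      h₄ : NotBothMinus (P j · s 2 j) (W j · (sval s j (5 + m) · minus))
      h₄ = notBothMinus-subst (trans (twoRows-suc (5 + m) j) (cong (λ σ → P j · (σ · s 2 j)) y))
                              (trans (W-suc j) (cong (λ σ → W j · (sval s j (5 + m) · σ)) x))
                              (cut-P-W (ℕ.m<n⇒m<1+n 3<j) (ℕ.+-monoʳ-≤ 4 k<m))
  ... | inj₁ z = inj₁ z
  ... | inj₂ w = inj₂ (trans (sym (sval-< s (ℕ.+-monoʳ-< 4 (ℕ.m<n⇒m<1+n k<m)))) w)

  y-flip-middle : ∀ {k} → k < m → s 0 (4 + k) ≡ plus → s 1 (4 + k) ≡ minus →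
    s 2 (4 + k) ≡ minus ⊎ s (4 + k) (5 + m) ≡ minus
  y-flip-middle {k} k<m x y with neighbouring-cuts-y (Y j) (V j) (P j) (s 2 j) (sval s j (5 + m)) h₁ h₂ h₃ h₄
    where
      j : ℕ
      j = 4 + k
      h₁ : NotBothMinus (Y j) (V j)
      h₁ = cut-Y-V (s≤s (s≤s (s≤s z≤n))) (ℕ.+-monoʳ-≤ 4 (ℕ.<⇒≤ k<m))
      h₂ : NotBothMinus (Y j · minus) (V j · (sval s j (5 + m) · plus))
      h₂ = notBothMinus-subst (trans (Y-suc j) (cong (Y j ·_) y))
                              (trans (V-suc j) (cong (λ σ → V j · (sval s j (5 + m) · σ)) x))
                              (cut-Y-V (s≤s (s≤s (s≤s z≤n))) (ℕ.+-monoʳ-≤ 4 k<m))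
      h₃ : NotBothMinus (P j) (V j · minus)
      h₃ = notBothMinus-subst refl (W≡V·minus j) (cut-P-W (s≤s (s≤s (s≤s (s≤s z≤n)))) (ℕ.+-monoʳ-≤ 4 (ℕ.<⇒≤ k<m)))
      h₄ : NotBothMinus (P j · (minus · s 2 j)) ((V j · minus) · (sval s j (5 + m) · plus))
      h₄ = notBothMinus-subst (trans (twoRows-suc (5 + m) j) (cong (λ σ → P j · (σ · s 2 j)) y))
                              (trans (W-suc j) (cong₂ (λ ω σ → ω · (sval s j (5 + m) · σ)) (W≡V·minus j) x))
                              (cut-P-W (s≤s (s≤s (s≤s (s≤s z≤n)))) (ℕ.+-monoʳ-≤ 4 k<m))
  ... | inj₁ z = inj₁ z
  ... | inj₂ w = inj₂ (trans (sym (sval-< s (ℕ.+-monoʳ-< 4 (ℕ.m<n⇒m<1+n k<m)))) w)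

  y-flip-last : s 1 (4 + m) ≡ minus → s 2 (4 + m) ≡ minus
  y-flip-last y = neighbouring-cuts-last (Y j) (V j) (P j) (s 2 j) Y-end P-end h₁ h₃
    where
      j : ℕ
      j = 4 + m
      Y-end : Y j · minus ≡ plus
      Y-end = trans (cong (Y j ·_) (sym y)) (trans (sym (Y-suc j)) (·-inverse (π 1 (5 + m))))
      P-end : P j · (minus · s 2 j) ≡ plus
      P-end = trans (cong (λ σ → P j · (σ · s 2 j)) (sym y)) (trans (sym (twoRows-suc (5 + m) j)) P-last)
      h₁ : NotBothMinus (Y j) (V j)
      h₁ = cut-Y-V (s≤s (s≤s (s≤s z≤n))) ℕ.≤-refl
      h₃ : NotBothMinus (P j) (V j · minus)
      h₃ = notBothMinus-subst refl (W≡V·minus j) (cut-P-W (s≤s (s≤s (s≤s (s≤s z≤n)))) ℕ.≤-refl)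

  flip-hits-negative : ∀ {k} → k < 2 + m → s 0 (3 + k) · s 1 (3 + k) ≡ minus →
    (k ≢ 0 × s 2 (3 + k) ≡ minus) ⊎ (k ≢ 1 + m × s (3 + k) (5 + m) ≡ minus)
  flip-hits-negative {zero} _ xy with ·-minus-cases xy
  ... | inj₁ (x , _) = inj₂ ((λ ()) , x-flip-first x)
  ... | inj₂ (_ , y) = ⊥-elim (plus≢minus (trans (sym s-1-3) y))
  flip-hits-negative {suc k} (s≤s k<) xy with ℕ.m≤n⇒m<n∨m≡n (ℕ.≤-pred k<) | ·-minus-cases xy
  ... | inj₁ k<m | inj₁ (x , y) = Sum.map ((λ ()) ,_) (ℕ.<⇒≢ (s≤s k<m) ,_) (x-flip-middle k<m x y)
  ... | inj₁ k<m | inj₂ (x , y) = Sum.map ((λ ()) ,_) (ℕ.<⇒≢ (s≤s k<m) ,_) (y-flip-middle k<m x y)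
  ... | inj₂ refl | inj₁ (x , _) = ⊥-elim (plus≢minus (trans (sym s-0-penultimate) x))
  ... | inj₂ refl | inj₂ (_ , y) = inj₁ ((λ ()) , y-flip-last y)

-- Counting negative entries

∑<-mono-≤ : ∀ n {f g : ℕ → ℕ} → (∀ k → k < n → f k ≤ g k) → ℕ-Sum.∑< n f ≤ ℕ-Sum.∑< n g
∑<-mono-≤ zero    _   = z≤n
∑<-mono-≤ (suc n) f≤g = ℕ.+-mono-≤ (f≤g 0 (s≤s z≤n)) (∑<-mono-≤ n λ k k<n → f≤g (suc k) (s≤s k<n))

∑<-drop-ends : ∀ N (F G : ℕ → ℕ) →
  ℕ-Sum.∑< (suc N) (λ k → (if k ≡ᵇ 0 then 0 else F k) + (if k ≡ᵇ N then 0 else G k)) ≡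
  ℕ-Sum.∑< N (F ∘ suc) + ℕ-Sum.∑< N G
∑<-drop-ends N F G = trans (ℕ-Sum.∑<-∙ (suc N) (λ k → if k ≡ᵇ 0 then 0 else F k) (λ k → if k ≡ᵇ N then 0 else G k))
                           (cong (ℕ-Sum.∑< N (F ∘ suc) +_) drop-last)
  where
    drop-last : ℕ-Sum.∑< (suc N) (λ k → if k ≡ᵇ N then 0 else G k) ≡ ℕ-Sum.∑< N G
    drop-last = trans (ℕ-Sum.∑<-sucʳ N (λ k → if k ≡ᵇ N then 0 else G k))
                      (trans (cong₂ _+_ (ℕ-Sum.∑<-cong N λ k k<N → if-false (≡ᵇ-false (ℕ.<⇒≢ k<N))) (if-true (≡ᵇ-refl N)))
                             (ℕ.+-identityʳ _))

∑ᶜ-split : ∀ n (D : ℕ → ℕ → Bool) (G : ℕ → ℕ → ℕ) →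
  ℕ-Sum.∑ᶜ n G ≡
  ℕ-Sum.∑ᶜ n (λ i j → if D i j then G i j else 0) + ℕ-Sum.∑ᶜ n (λ i j → if D i j then 0 else G i j)
∑ᶜ-split n D G = trans (ℕ-Sum.∑ᶜ-cong n λ i j _ → split (D i j)) (ℕ-Sum.∑ᶜ-∙ n _ _)
  where
    split : ∀ {x} b → x ≡ (if b then x else 0) + (if b then 0 else x)
    split true  = sym (ℕ.+-identityʳ _)
    split false = refl

χ⁻-unless-≤1 : ∀ b σ → (if b then 0 else χ⁻ σ) ≤ 1
χ⁻-unless-≤1 true  σ     = z≤n
χ⁻-unless-≤1 false plus  = z≤n
χ⁻-unless-≤1 false minus = s≤s z≤n

flip-once-count : ∀ b₁ b₂ z w → (b₁ ≡ false × z ≡ minus) ⊎ (b₂ ≡ false × w ≡ minus) →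
  (if b₁ then 0 else χ⁻ (minus · z)) + (if b₂ then 0 else χ⁻ (minus · w)) ≤
  (if b₁ then 0 else χ⁻ z) + (if b₂ then 0 else χ⁻ w)
flip-once-count b₁ b₂ z w (inj₁ (refl , refl)) = ℕ.≤-trans (χ⁻-unless-≤1 b₂ (minus · w)) (s≤s z≤n)
flip-once-count b₁ b₂ z w (inj₂ (refl , refl)) = ℕ.≤-trans (ℕ.+-mono-≤ (χ⁻-unless-≤1 b₁ (minus · z)) z≤n) (ℕ.m≤n+m 1 _)

-- b₁ and b₂ switch off a term whose chord does not exist.
flip-count : ∀ b₁ b₂ x y z w → (x · y ≡ minus → (b₁ ≡ false × z ≡ minus) ⊎ (b₂ ≡ false × w ≡ minus)) →
  (if b₁ then 0 else χ⁻ (x · (y · z))) + (if b₂ then 0 else χ⁻ (x · (y · w))) ≤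
  (if b₁ then 0 else χ⁻ z) + (if b₂ then 0 else χ⁻ w)
flip-count b₁ b₂ plus  plus  z w _    = ℕ.≤-refl
flip-count b₁ b₂ minus minus z w _    rewrite ·-selfInverse minus z | ·-selfInverse minus w = ℕ.≤-refl
flip-count b₁ b₂ plus  minus z w paid = flip-once-count b₁ b₂ z w (paid refl)
flip-count b₁ b₂ minus plus  z w paid = flip-once-count b₁ b₂ z w (paid refl)

-- The chords with an endpoint in {0, 1, 2, L}: the only ones whose coordinate the swap can change.
touched : ℕ → ℕ → ℕ → Bool
touched m i j = (i ≤ᵇ 2) ∨ (j ≡ᵇ 5 + m)

touchedCount untouchedCount : ℕ → SignPattern → ℕ
touchedCount   m f = ℕ-Sum.∑ᶜ (6 + m) (λ i j → if touched m i j then χ⁻ (f i j) else 0)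
untouchedCount m f = ℕ-Sum.∑ᶜ (6 + m) (λ i j → if touched m i j then 0 else χ⁻ (f i j))

N-split : ∀ m f → N (6 + m) f ≡ touchedCount m f + untouchedCount m f
N-split m f = trans (N-∑ᶜ (6 + m) f) (∑ᶜ-split (6 + m) (touched m) (λ i j → χ⁻ (f i j)))

touchedCount-rows : ∀ m f → touchedCount m f ≡
  (χ⁻ (f 0 2) + ℕ-Sum.∑< (2 + m) (λ k → χ⁻ (f 0 (3 + k)))) +
  ((ℕ-Sum.∑< (2 + m) (λ k → χ⁻ (f 1 (3 + k))) + χ⁻ (f 1 (5 + m))) +
   ((ℕ-Sum.∑< (1 + m) (λ k → χ⁻ (f 2 (4 + k))) + χ⁻ (f 2 (5 + m))) + ℕ-Sum.∑< (1 + m) (λ k → χ⁻ (f (3 + k) (5 + m)))))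
touchedCount-rows m f =
  cong₂ _+_ (ℕ-Sum.∑ᶜ-row-0 m (λ j → χ⁻ (f 0 j)))
            (cong₂ _+_ (ℕ-Sum.∑ᶜ-row-1 m (λ j → χ⁻ (f 1 j))) (cong₂ _+_ (ℕ-Sum.∑ᶜ-row-2 m (λ j → χ⁻ (f 2 j))) lastColumn))
  where
    lastColumn : ℕ-Sum.∑< (3 + m) (λ k → ℕ-Sum.∑ᶜ-row (6 + m) (3 + k) (λ j → if j ≡ᵇ 5 + m then χ⁻ (f (3 + k) j) else 0))
                 ≡ ℕ-Sum.∑< (1 + m) (λ k → χ⁻ (f (3 + k) (5 + m)))
    lastColumn = trans (ℕ-Sum.∑<-cong (3 + m) λ k _ →
                          ℕ-Sum.∑ᶜ-row-single (6 + m) (3 + k) (5 + m) (λ j → χ⁻ (f (3 + k) j)) (ℕ.n<1+n _))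
                       (ℕ-Sum.∑<-column-last m (λ k → χ⁻ (f (3 + k) (5 + m))))

module SwapDecreases (m : ℕ) {s t : SignPattern} (consistent : Consistent (6 + m) s) (s-2-last : s 2 (5 + m) ≡ minus)
  (short-plus : ∀ i j → IsChord (6 + m) i j → cycLen (6 + m) i j ≡ 2 → s i j ≡ plus)
  (transported : IsTransport (6 + m) s swap13 t) where

  open Swap13Transport m transported
  open ConsistencyConsequences m s consistent s-2-last short-plus
  open ℕ-Sum using (∑<; ∑<-cong)

  untouched-unchanged : untouchedCount m t ≡ untouchedCount m s
  untouched-unchanged = ℕ-Sum.∑ᶜ-cong (6 + m) λ i j c → unchanged i j c (touched m i j) refl
    where
      unchanged : ∀ i j → isChordᵇ (6 + m) i j ≡ true → ∀ b → touched m i j ≡ b →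
        (if b then 0 else χ⁻ (t i j)) ≡ (if b then 0 else χ⁻ (s i j))
      unchanged i j c true  _ = refl
      unchanged i j c false u = cong χ⁻ (t-unmoved c 3≤i j≤)
        where
          3≤i : 3 ≤ i
          3≤i = ℕ.≰⇒> λ i≤2 → subst T (∨-conicalˡ _ _ u) (ℕ.≤⇒≤ᵇ i≤2)
          j≤ : j ≤ 4 + m
          j≤ = ℕ.≤-pred (ℕ.≤∧≢⇒< (ℕ.≤-pred (ChordBounds.j<n (chord-elim {6 + m} {i} {j} c)))
                                 λ j≡ → subst T (∨-conicalʳ (i ≤ᵇ 2) _ u) (ℕ.≡⇒≡ᵇ j (5 + m) j≡))

  Sx Sy flipped unflipped : ℕ
  Sx = ∑< (2 + m) (λ k → χ⁻ (s 0 (3 + k)))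
  Sy = ∑< (2 + m) (λ k → χ⁻ (s 1 (3 + k)))
  flipped   = ∑< (1 + m) (λ k → χ⁻ (s 0 (4 + k) · (s 1 (4 + k) · s 2 (4 + k)))) +
              ∑< (1 + m) (λ k → χ⁻ (s 0 (3 + k) · (s 1 (3 + k) · s (3 + k) (5 + m))))
  unflipped = ∑< (1 + m) (λ k → χ⁻ (s 2 (4 + k))) + ∑< (1 + m) (λ k → χ⁻ (s (3 + k) (5 + m)))

  flipped≤unflipped : flipped ≤ unflipped
  flipped≤unflipped = subst₂ _≤_ (∑<-drop-ends (1 + m) (λ k → χ⁻ (s 0 (3 + k) · (s 1 (3 + k) · s 2 (3 + k))))
                                                       (λ k → χ⁻ (s 0 (3 + k) · (s 1 (3 + k) · s (3 + k) (5 + m)))))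
                                 (∑<-drop-ends (1 + m) (λ k → χ⁻ (s 2 (3 + k))) (λ k → χ⁻ (s (3 + k) (5 + m))))
    (∑<-mono-≤ (2 + m) λ k k< → flip-count (k ≡ᵇ 0) (k ≡ᵇ 1 + m) (s 0 (3 + k)) (s 1 (3 + k)) (s 2 (3 + k)) (s (3 + k) (5 + m))
                                   λ xy → Sum.map (Product.map₁ ≡ᵇ-false) (Product.map₁ ≡ᵇ-false) (flip-hits-negative k< xy))

  touchedCount-t : touchedCount m t ≡ Sx + (Sy + flipped)
  touchedCount-t = begin
    touchedCount m t
      ≡⟨ touchedCount-rows m t ⟩
    (χ⁻ (t 0 2) + ∑< (2 + m) (λ k → χ⁻ (t 0 (3 + k)))) +
    ((∑< (2 + m) (λ k → χ⁻ (t 1 (3 + k))) + χ⁻ (t 1 (5 + m))) +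
     ((∑< (1 + m) (λ k → χ⁻ (t 2 (4 + k))) + χ⁻ (t 2 (5 + m))) + ∑< (1 + m) (λ k → χ⁻ (t (3 + k) (5 + m)))))
      ≡⟨ cong₂ _+_ (cong₂ _+_ t-0-2-plus (∑<-cong (2 + m) λ k k< → cong χ⁻ (t-row0 (ℕ.≤-pred k<))))
                   (cong₂ _+_ (cong₂ _+_ (∑<-cong (2 + m) λ k k< → cong χ⁻ (t-row1 (ℕ.≤-pred k<))) t-1-last-plus)
                              (cong₂ _+_ (cong₂ _+_ (∑<-cong (1 + m) λ k k< → cong χ⁻ (t-row2 (ℕ.≤-pred k<))) t-2-last-plus)
                                         (∑<-cong (1 + m) λ k k< → cong χ⁻ (t-last (ℕ.≤-pred k<))))) ⟩
    Sy + ((Sx + 0) + ((Tz + 0) + Tw))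
      ≡⟨ cong₂ (λ a b → Sy + (a + (b + Tw))) (ℕ.+-identityʳ Sx) (ℕ.+-identityʳ Tz) ⟩
    Sy + (Sx + flipped)
      ≡⟨ ℕ-Algebra.x∙yz≈y∙xz Sy Sx flipped ⟩
    Sx + (Sy + flipped) ∎
    where
      open ≡-Reasoning
      Tz Tw : ℕ
      Tz = ∑< (1 + m) (λ k → χ⁻ (s 0 (4 + k) · (s 1 (4 + k) · s 2 (4 + k))))
      Tw = ∑< (1 + m) (λ k → χ⁻ (s 0 (3 + k) · (s 1 (3 + k) · s (3 + k) (5 + m))))
      t-0-2-plus : χ⁻ (t 0 2) ≡ 0
      t-0-2-plus = cong χ⁻ (trans t-0-2 (cong₂ _·_ row-1-product s-1-last))
      t-1-last-plus : χ⁻ (t 1 (5 + m)) ≡ 0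
      t-1-last-plus = cong χ⁻ (trans t-1-last (cong₂ _·_ s-0-2 row-0-product))
      t-2-last-plus : χ⁻ (t 2 (5 + m)) ≡ 0
      t-2-last-plus = cong χ⁻ (trans t-2-last (cong (minus ·_) (cong₂ _·_ row-0-product (cong₂ _·_ row-1-product s-2-last))))

  touchedCount-s : touchedCount m s ≡ Sx + (Sy + suc unflipped)
  touchedCount-s = begin
    touchedCount m s
      ≡⟨ touchedCount-rows m s ⟩
    (χ⁻ (s 0 2) + Sx) + ((Sy + χ⁻ (s 1 (5 + m))) + ((Sz + χ⁻ (s 2 (5 + m))) + Sw))
      ≡⟨ cong₂ (λ σ ρ → (χ⁻ σ + Sx) + ρ) s-0-2
               (cong₂ (λ σ τ → (Sy + χ⁻ σ) + ((Sz + χ⁻ τ) + Sw)) s-1-last s-2-last) ⟩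
    Sx + ((Sy + 0) + ((Sz + 1) + Sw))
      ≡⟨ cong₂ (λ a b → Sx + (a + (b + Sw))) (ℕ.+-identityʳ Sy) (ℕ.+-comm Sz 1) ⟩
    Sx + (Sy + suc unflipped) ∎
    where
      open ≡-Reasoning
      Sz Sw : ℕ
      Sz = ∑< (1 + m) (λ k → χ⁻ (s 2 (4 + k)))
      Sw = ∑< (1 + m) (λ k → χ⁻ (s (3 + k) (5 + m)))

  touched-decreases : touchedCount m t < touchedCount m s
  touched-decreases = subst₂ _<_ (sym touchedCount-t) (sym touchedCount-s)
                             (ℕ.+-monoʳ-< Sx (ℕ.+-monoʳ-< Sy (s≤s flipped≤unflipped)))

corollary3p8 : (n : ℕ) (s : SignPattern) →
    Consistent n s →
    IsChord n 2 (n ∸ 1) →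
    s 2 (n ∸ 1) ≡ minus →
    (∀ i j → IsChord n i j → cycLen n i j ≡ 2 → s i j ≡ plus) →
    (t : SignPattern) → IsTransport n s swap13 t →
    N n t < N n s
corollary3p8 0 _ _ () _ _ _ _
corollary3p8 1 _ _ () _ _ _ _
corollary3p8 2 _ _ () _ _ _ _
corollary3p8 3 _ _ () _ _ _ _
corollary3p8 4 _ _ () _ _ _ _
corollary3p8 5 _ _ chord s-2-4 short-plus _ _ = ⊥-elim (plus≢minus (trans (sym (short-plus 2 4 chord refl)) s-2-4))
corollary3p8 (suc (suc (suc (suc (suc (suc m)))))) s consistent _ s-2-last short-plus t transported = begin-strict
  N (6 + m) t                            ≡⟨ N-split m t ⟩
  touchedCount m t + untouchedCount m t  ≡⟨ cong (touchedCount m t +_) untouched-unchanged ⟩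
  touchedCount m t + untouchedCount m s  <⟨ ℕ.+-monoˡ-< (untouchedCount m s) touched-decreases ⟩
  touchedCount m s + untouchedCount m s  ≡⟨ N-split m s ⟨
  N (6 + m) s                            ∎
  where
    open SwapDecreases m consistent s-2-last short-plus transported
    open ℕ.≤-Reasoning
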